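{- For every $n\ge0$, $$\sum_{T\in\mathcal T(n)} x^{\mathrm{Rec}(T)}y^{\mathrm{wait}(T)}z^{\mathrm{psa}(T)}t^{\deg_\circ(T)}w^{\mathrm{chseq}(T)}q^{\mathrm{ord}(T)}=\sum_{\pi\in\mathcal{PF}(n)} x^{\mathrm{Rec}(\pi)}y^{\mathrm{probes}(\pi)}z^{\mathrm{lucky}(\pi)}t^{\mathrm{ones}(\pi)}w^{\mathrm{mult}(\pi)}q^{\mathrm{len}(\pi)},$$ where $x^{\{a_1,\dots,a_k\}}=x_{a_1}\cdots x_{a_k}$ and $w^{(b_1,\dots,b_k)}=w_{b_1}\cdots w_{b_k}$.
   Context: $\mathcal T(n)$ is the set of Cayley trees labelled with $[n]_0=\{0,\dots,n\}$: trees on $[n]_0$ rooted at $0$, with parent map $f_T$. A non-root vertex $k$ is a record if it is the largest label on its path to the root; $\mathrm{Rec}(T)$ is the set of records. Weary permutation $\omega_T$: run priority-first search from $0$ (visit at each step the smallest unvisited vertex adjacent to a visited one); $\omega_T(i)$ is the $i$-th non-root vertex visited, $\omega_T(0)=0$. $\mathrm{pt}(T)$ is $T$ with each vertex $v$ relabelled $\omega_T^{ -1}(v)$. $\mathrm{ord}(T)=n$; $\deg_\circ(T)$ = number of children of $0$; $\mathrm{chseq}(T)=(\tau_0,\dots,\tau_n)$, $\tau_i$ = number of vertices (root included) with exactly $i$ children; $\mathrm{wait}(T)=\sum_{i=1}^n(i-f_{\mathrm{pt}(T)}(i))$; $\mathrm{psa}(T)=\#\{i\in[n]: f_{\mathrm{pt}(T)}(i)=i-1\}$.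 $\mathcal{PF}(n)$ is the set of parking functions $\pi=(a_1,\dots,a_n)$, $a_i\in[n]$: cars $1,\dots,n$ enter in order a street with spots $1,\dots,n$, car $i$ parks in the first free spot $j\ge a_i$, and all cars park. $\omega_\pi(j)$ = car in spot $j$; $\mathrm{Rec}(\pi)$ = left-to-right maxima of $\omega_\pi(1)\cdots\omega_\pi(n)$; $\mathrm{len}(\pi)=n$; $\mathrm{lucky}(\pi)$ = number of cars parking in their preferred spot; $\mathrm{probes}(\pi)=n+\sum(\text{final spot}-\text{preferred spot})$ over cars; $\mathrm{ones}(\pi)=\#\{i:a_i=1\}$; $\mathrm{mult}(\pi)=(\mu_0,\dots,\mu_n)$, $\mu_i$ = number of elements of $[n+1]$ appearing exactly $i$ times in $\pi$. -}

module Defs where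

open import Data.Nat using (ℕ; zero; suc; _+_; _∸_; _≤ᵇ_; _≡ᵇ_; _<ᵇ_)
open import Data.Fin using (Fin; zero; suc; toℕ)
open import Data.Bool using (Bool; true; false; _∧_; _∨_; not)
open import Data.List using (List; []; _∷_; _++_; map; concatMap; filterᵇ; length; allFin; upTo; zipWith)
open import Data.Bool.ListAction using (all; any)
open import Data.Nat.ListAction using (sum)
open import Data.Vec using (Vec; []; _∷_; lookup; tabulate; toList)
open import Data.Maybe using (Maybe; just; nothing; is-just; fromMaybe)
open import Data.Product using (_×_; _,_; proj₁; proj₂)
open import Function using (_∘_)

allVecs : (m k : ℕ) → List (Vec (Fin m) k)
allVecs m zero = [] ∷ []
allVecs m (suc k) = concatMap (λ x → map (x ∷_) (allVecs m k)) (allFin m)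

count : {A : Set} → (A → Bool) → List A → ℕ
count p xs = length (filterᵇ p xs)

_==_ : {m : ℕ} → Fin m → Fin m → Bool
i == j = toℕ i ≡ᵇ toℕ j

isZero : {m : ℕ} → Fin m → Bool
isZero i = toℕ i ≡ᵇ 0

iter : {A : Set} → ℕ → (A → A) → A → A
iter zero f a = a
iter (suc k) f a = iter k f (f a)

-- position (0-based) of the first occurrence of x in xs (length xs if absent)
pos : {A : Set} → (A → A → Bool) → A → List A → ℕ
pos eq x [] = 0
pos eq x (y ∷ ys) with eq x y
... | true = 0
... | false = suc (pos eq x ys)

nthOr : {A : Set} → A → List A → ℕ → A
nthOr d [] k = d
nthOr d (x ∷ xs) zero = x
nthOr d (x ∷ xs) (suc k) = nthOr d xs k

-- Exponent vector of the monomial w^(b_1,...,b_k) = w_{b_1} ⋯ w_{b_k}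
-- in the variables w_0,...,w_{m-1}: the j-th entry is #{ i : b_i = j }.
expVec : (m : ℕ) → List ℕ → Vec ℕ m
expVec m bs = tabulate (λ (j : Fin m) → count (λ b → b ≡ᵇ toℕ j) bs)

lrMaxFrom : ℕ → List ℕ → List ℕ
lrMaxFrom m [] = []
lrMaxFrom m (x ∷ xs) with m <ᵇ x
... | true = x ∷ lrMaxFrom x xs
... | false = lrMaxFrom m xs

-- Cayley trees on [n]_0 = Fin (suc n), rooted at 0.
-- A tree is given by its parent map on the non-root vertices:
-- the parent of vertex (suc i) is lookup p i.

Parents : ℕ → Set
Parents n = Vec (Fin (suc n)) n

parent : {n : ℕ} → Parents n → Fin (suc n) → Fin (suc n)
parent p zero = zero
parent p (suc i) = lookup p i

-- the parent map defines a tree rooted at 0 iff every vertex reaches 0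
isTreeᵇ : {n : ℕ} → Parents n → Bool
isTreeᵇ {n} p = all (λ v → isZero (iter n (parent p) v)) (allFin (suc n))

trees : (n : ℕ) → List (Parents n)
trees n = filterᵇ isTreeᵇ (allVecs (suc n) n)

isRecordᵇ : {n : ℕ} → Parents n → Fin (suc n) → Bool
isRecordᵇ {n} p k = all (λ j → toℕ (iter j (parent p) k) ≤ᵇ toℕ k) (upTo (suc n))

-- Rec(T) as a subset of [n]: entry i says whether label (i+1) is a record
recT : {n : ℕ} → Parents n → Vec Bool n
recT p = tabulate (λ i → isRecordᵇ p (suc i))

degRoot : {n : ℕ} → Parents n → ℕ
degRoot p = count isZero (toList p)

childCount : {n : ℕ} → Parents n → Fin (suc n) → ℕ
childCount p v = count (λ u → u == v) (toList p)

chseq : {n : ℕ} → Parents n → List ℕ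
chseq {n} p = map (λ i → count (λ v → childCount p v ≡ᵇ i) (allFin (suc n))) (upTo (suc n))

adjᵇ : {n : ℕ} → Parents n → Fin (suc n) → Fin (suc n) → Bool
adjᵇ p u v = (not (isZero v) ∧ (parent p v == u)) ∨ (not (isZero u) ∧ (parent p u == v))

memᵇ : {m : ℕ} → Fin m → List (Fin m) → Bool
memᵇ v xs = any (v ==_) xs

searchStep : {n : ℕ} → Parents n → List (Fin (suc n)) → Maybe (Fin (suc n))
searchStep {n} p vis with filterᵇ (λ v → not (memᵇ v vis) ∧ any (λ u → adjᵇ p u v) vis) (allFin (suc n))
... | [] = nothing
... | v ∷ _ = just v

visit : {n : ℕ} → ℕ → Parents n → List (Fin (suc n)) → List (Fin (suc n))
visit zero p vis = vis
visit (suc k) p vis with searchStep p vis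
... | nothing = vis
... | just v = visit k p (vis ++ (v ∷ []))

-- priority-first search order: ω_T(0), ω_T(1), …, ω_T(n)
weary : {n : ℕ} → Parents n → List (Fin (suc n))
weary {n} p = visit n p (zero ∷ [])

weary⁻¹ : {n : ℕ} → Parents n → Fin (suc n) → ℕ
weary⁻¹ p v = pos _==_ v (weary p)

ptPairs : {n : ℕ} → Parents n → List (ℕ × ℕ)
ptPairs {n} p = map (λ i → i , weary⁻¹ p (parent p (nthOr zero (weary p) i))) (map suc (upTo n))

wait : {n : ℕ} → Parents n → ℕ
wait p = sum (map (λ ij → proj₁ ij ∸ proj₂ ij) (ptPairs p))

psa : {n : ℕ} → Parents n → ℕ
psa p = count (λ ij → suc (proj₂ ij) ≡ᵇ proj₁ ij) (ptPairs p)

-- Parking functions: a vector a of length n with entries in Fin n,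
-- the preference of car i+1 being toℕ (lookup a i) + 1 ∈ [n].

prefs : {n : ℕ} → Vec (Fin n) n → List ℕ
prefs a = map (suc ∘ toℕ) (toList a)

firstFree : ℕ → ℕ → List ℕ → Maybe ℕ
firstFree n a occ with filterᵇ (λ j → (a ≤ᵇ j) ∧ not (any (j ≡ᵇ_) occ)) (map suc (upTo n))
... | [] = nothing
... | j ∷ _ = just j

-- occ: spots of the cars parked so far, in car order
parkFrom : ℕ → List ℕ → List ℕ → Maybe (List ℕ)
parkFrom n occ [] = just occ
parkFrom n occ (a ∷ as) with firstFree n a occ
... | nothing = nothing
... | just j = parkFrom n (occ ++ (j ∷ [])) as

isPFᵇ : {n : ℕ} → Vec (Fin n) n → Bool
isPFᵇ {n} a = is-just (parkFrom n [] (prefs a))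

pfs : (n : ℕ) → List (Vec (Fin n) n)
pfs n = filterᵇ isPFᵇ (allVecs n n)

spots : {n : ℕ} → Vec (Fin n) n → List ℕ
spots {n} a = fromMaybe [] (parkFrom n [] (prefs a))

-- ω_π(1) ⋯ ω_π(n): car in spot j
carWord : {n : ℕ} → Vec (Fin n) n → List ℕ
carWord {n} a = map (λ j → suc (pos _≡ᵇ_ j (spots a))) (map suc (upTo n))

recP : {n : ℕ} → Vec (Fin n) n → Vec Bool n
recP a = tabulate (λ i → any (suc (toℕ i) ≡ᵇ_) (lrMaxFrom 0 (carWord a)))

lucky : {n : ℕ} → Vec (Fin n) n → ℕ
lucky a = count (λ b → b) (zipWith _≡ᵇ_ (spots a) (prefs a))

probes : {n : ℕ} → Vec (Fin n) n → ℕ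
probes {n} a = n + sum (zipWith _∸_ (spots a) (prefs a))

ones : {n : ℕ} → Vec (Fin n) n → ℕ
ones a = count (1 ≡ᵇ_) (prefs a)

mult : {n : ℕ} → Vec (Fin n) n → List ℕ
mult {n} a = map (λ i → count (λ v → count (v ≡ᵇ_) (prefs a) ≡ᵇ i) (map suc (upTo (suc n)))) (upTo (suc n))

-- Monomials x^Rec y^· z^· t^· w^· q^·, encoded by their exponents.
-- x_1..x_n (0/1 exponents), y, z, t, w_0..w_{n+1}, q.
-- (entries of chseq and mult are ≤ n+1, so w_0..w_{n+1} suffice.)

Mono : ℕ → Set
Mono n = Vec Bool n × ℕ × ℕ × ℕ × Vec ℕ (suc (suc n)) × ℕ

treeMono : {n : ℕ} → Parents n → Mono n
treeMono {n} p = recT p , wait p , psa p , degRoot p , expVec (suc (suc n)) (chseq p) , n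

pfMono : {n : ℕ} → Vec (Fin n) n → Mono n
pfMono {n} a = recP a , probes a , lucky a , ones a , expVec (suc (suc n)) (mult a) , n

-- A tree T is sent to the parking function in which car i prefers spot 1 + ω_T⁻¹(f_T(i)),
-- one past the step at which the search visits the parent of i. The search always visits the
-- smallest unvisited child of a visited vertex and the cars arrive in increasing order; together
-- these force car i to park exactly in spot ω_T⁻¹(i), so ω_π = ω_T. Conversely, a parking
-- function gives the tree in which the parent of car i is the car parked in spot a_i − 1 (the
-- root when a_i = 1). Under this bijection, i is a record of T iff every vertex visited before
-- it is smaller, i.e. iff i is a left-to-right maximum of ω_π; car i is displaced by
-- ω_T⁻¹(i) − ω_T⁻¹(f_T(i)) − 1 spots, which gives wait = probes and psa = lucky; the children
-- of the root are the cars preferring spot 1; and ω_T(j) has as many children as there are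
-- cars preferring spot j + 1, so chseq(T) = mult(π).

module Submission where

open import Defs
open import Data.Nat
  using (ℕ; zero; suc; pred; _+_; _∸_; _≤ᵇ_; _≡ᵇ_; _<ᵇ_; _≤_; _<_; z≤n; s≤s; s≤s⁻¹; _≤?_; _<?_)
open import Data.Nat.Properties
open import Algebra.Properties.CommutativeSemigroup +-commutativeSemigroup using (x∙yz≈y∙xz)
open import Data.Nat.ListAction using (sum)
open import Data.Nat.ListAction.Properties using (sum-↭)
open import Data.Fin using (Fin; zero; suc; toℕ; fromℕ<)
open import Data.Fin.Properties using (toℕ-injective; toℕ-fromℕ<; toℕ<n)
import Data.Fin.Properties as Fin
open import Data.Bool using (Bool; true; false; _∧_; not; T; T?)
open import Data.Bool.Properties using (T-≡; T-∧; T-∨)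
open import Data.Bool.ListAction using (any)
open import Data.List
  using (List; []; _∷_; _++_; [_]; head; map; length; take; filter; filterᵇ; upTo; allFin; applyUpTo; tabulate; zipWith)
open import Data.List.Properties
  using ( length-++; length-++-≤ˡ; length-map; length-tabulate; length-applyUpTo; length-take; take-all
        ; map-tabulate; map-applyUpTo; map-∘; map-cong; map-cong-local; map-id-local; tabulate-cong
        ; ++-identityʳ; ++-assoc)
open import Data.List.Membership.Propositional using (_∈_; _∉_; find)
open import Data.List.Membership.Propositional.Properties
  using (∈-∃++; ∈-map⁺; ∈-map⁻; ∈-allFin; ∈-upTo⁺; ∈-upTo⁻; ∈-filter⁺; ∈-filter⁻; ∈-concat⁺′)
open import Data.List.Membership.Propositional.Properties.WithK using (unique∧set⇒bag)
open import Data.List.Relation.Binary.Subset.Propositional using (_⊆_)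
open import Data.List.Relation.Unary.Any using (here; there; any?)
import Data.List.Relation.Unary.Any as Any
import Data.List.Relation.Unary.Any.Properties as Any
import Data.List.Relation.Unary.All as All
import Data.List.Relation.Unary.All.Properties as All
open import Data.List.Relation.Unary.AllPairs using (AllPairs; []; _∷_)
import Data.List.Relation.Unary.AllPairs as AllPairs
import Data.List.Relation.Unary.AllPairs.Properties as AllPairs
open import Data.List.Relation.Unary.Unique.Propositional using (Unique)
import Data.List.Relation.Unary.Unique.Propositional.Properties as Unique
open import Data.List.Relation.Binary.BagAndSetEquality using (∼bag⇒↭)
open import Data.List.Relation.Binary.Permutation.Propositional using (_↭_; module PermutationReasoning)
open import Data.List.Relation.Binary.Permutation.Propositional.Properties
  using (shift; filter-↭; ↭-length; map⁺; drop-∷; ∈-resp-↭)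
open import Data.Vec using (Vec; []; _∷_; lookup; toList)
import Data.Vec as Vec
import Data.Vec.Properties as Vec
open import Data.Maybe using (Maybe; just; is-just; fromMaybe)
open import Data.Product using (_×_; _,_; proj₁; proj₂; ∃-syntax)
open import Data.Sum using (_⊎_; inj₁; inj₂)
open import Data.Empty using (⊥-elim)
open import Data.Unit using (tt)
open import Function using (_∘_; id; _⟨_⟩_)
open import Function.Bundles using (_⇔_; mk⇔; Equivalence)
import Function.Properties.Equivalence as ⇔
open import Relation.Nullary using (¬_; yes; no)
open import Relation.Unary using (Decidable)
open import Relation.Binary.Definitions using (DecidableEquality)
open import Relation.Binary.PropositionalEquality
  using (_≡_; _≢_; refl; sym; trans; cong; cong₂; subst; subst₂; module ≡-Reasoning)

T-injective : {a b : Bool} → T a ⇔ T b → a ≡ b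
T-injective {true}  {true}  _   = refl
T-injective {true}  {false} a⇔b = ⊥-elim (Equivalence.to a⇔b tt)
T-injective {false} {true}  a⇔b = ⊥-elim (Equivalence.from a⇔b tt)
T-injective {false} {false} _   = refl

¬T⇒T-not : {a : Bool} → ¬ T a → T (not a)
¬T⇒T-not {true}  ¬t = ¬t tt
¬T⇒T-not {false} _  = tt

T-not⇒¬T : {a : Bool} → T (not a) → ¬ T a
T-not⇒¬T {true} ()

≡-true⇒T : {a : Bool} → a ≡ true → T a
≡-true⇒T = Equivalence.from T-≡

≡ᵇ-comm : (m k : ℕ) → (m ≡ᵇ k) ≡ (k ≡ᵇ m)
≡ᵇ-comm m k = T-injective (mk⇔ (flip m k) (flip k m))
  where
    flip : ∀ x y → T (x ≡ᵇ y) → T (y ≡ᵇ x)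
    flip x y t = ≡⇒≡ᵇ y x (sym (≡ᵇ⇒≡ x y t))

==⇒≡ : {m : ℕ} {i j : Fin m} → T (i == j) → i ≡ j
==⇒≡ {i = i} {j} t = toℕ-injective (≡ᵇ⇒≡ (toℕ i) (toℕ j) t)

==-refl : {m : ℕ} (i : Fin m) → T (i == i)
==-refl i = ≡⇒≡ᵇ (toℕ i) (toℕ i) refl

≡⇒== : {m : ℕ} {i j : Fin m} → i ≡ j → T (i == j)
≡⇒== {i = i} refl = ==-refl i

memᵇ⇔∈ : {m : ℕ} {v : Fin m} {xs : List (Fin m)} → T (memᵇ v xs) ⇔ v ∈ xs
memᵇ⇔∈ {v = v} {xs} = mk⇔
  (λ t → Any.map ==⇒≡ (Any.any⁻ (v ==_) xs t))
  (λ v∈ → Any.any⁺ (v ==_) (Any.map ≡⇒== v∈))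

T-isZero⇔ : {m : ℕ} {v : Fin m} → T (isZero v) ⇔ toℕ v ≡ 0
T-isZero⇔ {v = v} = mk⇔ (≡ᵇ⇒≡ (toℕ v) 0) (≡⇒≡ᵇ (toℕ v) 0)

T-is-just⇒ : {A : Set} {m : Maybe A} → T (is-just m) → ∃[ x ] m ≡ just x
T-is-just⇒ {m = just x} _ = x , refl

module _ {A : Set} where

  ∈-take⁻ : {x : A} (k : ℕ) (xs : List A) → x ∈ take k xs → x ∈ xs
  ∈-take⁻ (suc k) (y ∷ xs) (here e)   = here e
  ∈-take⁻ (suc k) (y ∷ xs) (there x∈) = there (∈-take⁻ k xs x∈)

  nthOr-∈ : (d : A) (xs : List A) {k : ℕ} → k < length xs → nthOr d xs k ∈ xs
  nthOr-∈ d (x ∷ xs) {zero}  _        = here refl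
  nthOr-∈ d (x ∷ xs) {suc k} (s≤s k<) = there (nthOr-∈ d xs k<)

  ∈⇒nthOr : (d : A) {xs : List A} {x : A} → x ∈ xs → ∃[ k ] k < length xs × nthOr d xs k ≡ x
  ∈⇒nthOr d (here refl) = zero , s≤s z≤n , refl
  ∈⇒nthOr d (there x∈) with k , k< , e ← ∈⇒nthOr d x∈ = suc k , s≤s k< , e

  nthOr-take : (d : A) (xs : List A) {j k : ℕ} → k < j → nthOr d (take j xs) k ≡ nthOr d xs k
  nthOr-take d []       {suc j} {k}     _        = refl
  nthOr-take d (x ∷ xs) {suc j} {zero}  _        = refl
  nthOr-take d (x ∷ xs) {suc j} {suc k} (s≤s k<) = nthOr-take d xs k<

  nthOr-++ˡ : (d : A) (xs ys : List A) {k : ℕ} → k < length xs → nthOr d (xs ++ ys) k ≡ nthOr d xs k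
  nthOr-++ˡ d (x ∷ xs) ys {zero}  _        = refl
  nthOr-++ˡ d (x ∷ xs) ys {suc k} (s≤s k<) = nthOr-++ˡ d xs ys k<

  nthOr-++-length : (d : A) (xs ys : List A) → nthOr d (xs ++ ys) (length xs) ≡ nthOr d ys 0
  nthOr-++-length d []       ys = refl
  nthOr-++-length d (x ∷ xs) ys = nthOr-++-length d xs ys

  take-++ˡ : (xs ys : List A) {k : ℕ} → k ≤ length xs → take k (xs ++ ys) ≡ take k xs
  take-++ˡ xs       ys {zero}  _        = refl
  take-++ˡ (x ∷ xs) ys {suc k} (s≤s k≤) = cong (x ∷_) (take-++ˡ xs ys k≤)

  take-suc-nthOr : (d : A) (xs : List A) {k : ℕ} → k < length xs → take (suc k) xs ≡ take k xs ++ [ nthOr d xs k ]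
  take-suc-nthOr d (x ∷ xs) {zero}  _        = refl
  take-suc-nthOr d (x ∷ xs) {suc k} (s≤s k<) = cong (x ∷_) (take-suc-nthOr d xs k<)

  <⇒nthOr∈take : (d : A) (xs : List A) {i k : ℕ} → i < k → i < length xs → nthOr d xs i ∈ take k xs
  <⇒nthOr∈take d (x ∷ xs) {zero}  {suc k} _        _        = here refl
  <⇒nthOr∈take d (x ∷ xs) {suc i} {suc k} (s≤s i<) (s≤s i<l) = there (<⇒nthOr∈take d xs i< i<l)

  nthOr-injective : (d : A) {xs : List A} → Unique xs → {i j : ℕ} → i < length xs → j < length xs →
                    nthOr d xs i ≡ nthOr d xs j → i ≡ j
  nthOr-injective d {x ∷ xs} (x∉ ∷ u) {zero}  {zero}  _        _        _ = refl
  nthOr-injective d {x ∷ xs} (x∉ ∷ u) {zero}  {suc j} _        (s≤s j<) e =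
    ⊥-elim (All.lookup x∉ (nthOr-∈ d xs j<) e)
  nthOr-injective d {x ∷ xs} (x∉ ∷ u) {suc i} {zero}  (s≤s i<) _        e =
    ⊥-elim (All.lookup x∉ (nthOr-∈ d xs i<) (sym e))
  nthOr-injective d {x ∷ xs} (x∉ ∷ u) {suc i} {suc j} (s≤s i<) (s≤s j<) e =
    cong suc (nthOr-injective d u i< j< e)

  <-length-take⁻ : (xs : List A) {i k : ℕ} → i < length (take k xs) → i < k × i < length xs
  <-length-take⁻ xs {k = k} i< =
    <-≤-trans i< (≤-trans length≡ (m⊓n≤m k (length xs))) ,
    <-≤-trans i< (≤-trans length≡ (m⊓n≤n k (length xs)))
    where length≡ = ≤-reflexive (length-take k xs)

  nthOr∈take⇒< : (d : A) {xs : List A} → Unique xs → {i k : ℕ} → i < length xs →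
                 nthOr d xs i ∈ take k xs → i < k
  nthOr∈take⇒< d {xs} u {k = k} i< x∈
    with j , j< , e ← ∈⇒nthOr d x∈
    with j<k , j<xs ← <-length-take⁻ xs j< =
    subst (_< k) (nthOr-injective d u j<xs i< (trans (sym (nthOr-take d xs j<k)) e)) j<k

  retraction⇒Unique : (d : A) (f : A → ℕ) (xs : List A) → (∀ {j} → j < length xs → f (nthOr d xs j) ≡ j) →
                      Unique xs
  retraction⇒Unique d f []       _       = []
  retraction⇒Unique d f (x ∷ xs) f-index =
    All.tabulate x∉ ∷ retraction⇒Unique d (pred ∘ f) xs (λ j< → cong pred (f-index (s≤s j<)))
    where
      x∉ : ∀ {y} → y ∈ xs → x ≢ y
      x∉ y∈ refl
        with k , k< , refl ← ∈⇒nthOr d y∈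
        with () ← trans (sym (f-index {0} (s≤s z≤n))) (f-index (s≤s k<))

  retraction-∈take⇒< : (d : A) (f : A → ℕ) (xs : List A) → (∀ {j} → j < length xs → f (nthOr d xs j) ≡ j) →
                       ∀ {x k} → x ∈ take k xs → f x < k
  retraction-∈take⇒< d f xs f-index {k = k} x∈
    with i , i< , refl ← ∈⇒nthOr d x∈
    with i<k , i<xs ← <-length-take⁻ xs i< =
    subst (_< k) (sym (trans (cong f (nthOr-take d xs i<k)) (f-index i<xs))) i<k

  fresh⇒Unique : (d : A) (xs : List A) → (∀ {c} → c < length xs → nthOr d xs c ∉ take c xs) → Unique xs
  fresh⇒Unique d xs fresh = subst Unique (take-all (length xs) xs ≤-refl) (prefix (length xs) ≤-refl)
    where
      prefix : ∀ k → k ≤ length xs → Unique (take k xs)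
      prefix zero    _  = []
      prefix (suc k) k< = subst Unique (sym (take-suc-nthOr d xs k<))
        (Unique.++⁺ (prefix k (<⇒≤ k<)) (All.[] ∷ []) λ { (x∈ , here refl) → fresh k< x∈ })

  nthOr-map-upTo : (d : A) (f : ℕ → A) {m k : ℕ} → k < m → nthOr d (map f (upTo m)) k ≡ f k
  nthOr-map-upTo d f {suc m} {zero}  _        = refl
  nthOr-map-upTo d f {suc m} {suc k} (s≤s k<) = begin
    nthOr d (map f (applyUpTo suc m)) k   ≡⟨ cong (λ xs → nthOr d xs k) (map-applyUpTo suc f m) ⟩
    nthOr d (applyUpTo (f ∘ suc) m) k     ≡⟨ cong (λ xs → nthOr d xs k) (map-applyUpTo id (f ∘ suc) m) ⟨
    nthOr d (map (f ∘ suc) (upTo m)) k    ≡⟨ nthOr-map-upTo d (f ∘ suc) k< ⟩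
    f (suc k)                             ∎
    where open ≡-Reasoning

  take-⊆-take : (xs : List A) {i k : ℕ} → i ≤ k → take i xs ⊆ take k xs
  take-⊆-take (y ∷ xs) {suc i} {suc k} (s≤s i≤k) (here e)  = here e
  take-⊆-take (y ∷ xs) {suc i} {suc k} (s≤s i≤k) (there x∈) = there (take-⊆-take xs i≤k x∈)

  length-∷ʳ : (xs : List A) (x : A) → length (xs ++ [ x ]) ≡ suc (length xs)
  length-∷ʳ xs x = trans (length-++ xs) (+-comm (length xs) 1)

  nthOr-tabulate : {m : ℕ} (d : A) (f : Fin m → A) (i : Fin m) → nthOr d (tabulate f) (toℕ i) ≡ f i
  nthOr-tabulate d f zero    = refl
  nthOr-tabulate d f (suc i) = nthOr-tabulate d (f ∘ suc) i

  ∈-take-tabulate⁻ : {m : ℕ} (f : Fin m → A) (c : ℕ) {x : A} → x ∈ take c (tabulate f) →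
                     ∃[ i ] toℕ i < c × x ≡ f i
  ∈-take-tabulate⁻ {suc m} f (suc c) (here refl) = zero , s≤s z≤n , refl
  ∈-take-tabulate⁻ {suc m} f (suc c) (there x∈)
    with i , i< , e ← ∈-take-tabulate⁻ (f ∘ suc) c x∈ = suc i , s≤s i< , e

  ∈-take-tabulate⁺ : {m : ℕ} (f : Fin m → A) {c : ℕ} (i : Fin m) → toℕ i < c → f i ∈ take c (tabulate f)
  ∈-take-tabulate⁺ f {suc c} zero    _        = here refl
  ∈-take-tabulate⁺ f {suc c} (suc i) (s≤s i<) = there (∈-take-tabulate⁺ (f ∘ suc) i i<)

  map-nthOr-upTo : (d : A) (xs : List A) → map (nthOr d xs) (upTo (length xs)) ≡ xs
  map-nthOr-upTo d []       = refl
  map-nthOr-upTo d (x ∷ xs) = cong (x ∷_) (begin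
    map (nthOr d (x ∷ xs)) (applyUpTo suc (length xs))   ≡⟨ map-applyUpTo suc (nthOr d (x ∷ xs)) (length xs) ⟩
    applyUpTo (nthOr d xs) (length xs)                   ≡⟨ map-applyUpTo id (nthOr d xs) (length xs) ⟨
    map (nthOr d xs) (upTo (length xs))                  ≡⟨ map-nthOr-upTo d xs ⟩
    xs                                                   ∎)
    where open ≡-Reasoning

toList≡tabulate-lookup : {A : Set} {m : ℕ} (v : Vec A m) → toList v ≡ tabulate (lookup v)
toList≡tabulate-lookup []      = refl
toList≡tabulate-lookup (x ∷ v) = cong (x ∷_) (toList≡tabulate-lookup v)

upTo-suc : (n : ℕ) → upTo (suc n) ≡ 0 ∷ map suc (upTo n)
upTo-suc n = cong (0 ∷_) (sym (map-applyUpTo id suc n))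

∀Fin⇒∀< : {m : ℕ} {P : ℕ → Set} → (∀ (i : Fin m) → P (toℕ i)) → ∀ {c} → c < m → P c
∀Fin⇒∀< {P = P} h c< = subst P (toℕ-fromℕ< c<) (h (fromℕ< c<))

fromℕ-or : {m : ℕ} → ℕ → Fin m → Fin m
fromℕ-or {m} k d with k <? m
... | yes k<m = fromℕ< k<m
... | no  _   = d

toℕ-fromℕ-or : {m k : ℕ} {d : Fin m} → k < m → toℕ (fromℕ-or k d) ≡ k
toℕ-fromℕ-or {m} {k} k<m with k <? m
... | yes k<m′ = toℕ-fromℕ< k<m′
... | no  k≮m  = ⊥-elim (k≮m k<m)

fromℕ-or-toℕ : {m : ℕ} (i d : Fin m) → fromℕ-or (toℕ i) d ≡ i
fromℕ-or-toℕ i d = toℕ-injective (toℕ-fromℕ-or (toℕ<n i))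

module _ {A : Set} where

  Unique⇒length≤ : {xs ys : List A} → Unique xs → xs ⊆ ys → length xs ≤ length ys
  Unique⇒length≤ {[]}     _          _   = z≤n
  Unique⇒length≤ {x ∷ xs} {ys} (x∉ ∷ u) sub with us , vs , refl ← ∈-∃++ (sub (here refl)) =
    subst (suc (length xs) ≤_) (sym (↭-length ys↭))
      (s≤s (Unique⇒length≤ u (λ z∈ → drop-x z∈ (∈-resp-↭ ys↭ (sub (there z∈))))))
    where
      ys↭ : us ++ [ x ] ++ vs ↭ x ∷ us ++ vs
      ys↭ = shift x us vs
      drop-x : ∀ {z} → z ∈ xs → z ∈ x ∷ us ++ vs → z ∈ us ++ vs
      drop-x z∈ (here refl) = ⊥-elim (All.lookup x∉ z∈ refl)
      drop-x z∈ (there z∈′) = z∈′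

  module _ (_≟_ : DecidableEquality A) where

    open import Data.List.Membership.DecPropositional _≟_ using (_∈?_; _∉?_)

    Unique-length≥⇒⊇ : {xs ys : List A} → Unique xs → xs ⊆ ys → length ys ≤ length xs → ys ⊆ xs
    Unique-length≥⇒⊇ {xs} u sub ys≤ {y} y∈ with y ∈? xs
    ... | yes y∈xs = y∈xs
    ... | no  y∉xs = ⊥-elim (<⇒≱ (≤-trans (Unique⇒length≤ (All.¬Any⇒All¬ xs y∉xs ∷ u) y∷xs⊆) ys≤)
                                  ≤-refl)
      where
        y∷xs⊆ : y ∷ xs ⊆ _
        y∷xs⊆ (here refl) = y∈
        y∷xs⊆ (there z∈)  = sub z∈

    Unique-length<⇒missing : {xs ys : List A} → Unique ys → length xs < length ys → ∃[ y ] y ∈ ys × y ∉ xs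
    Unique-length<⇒missing {xs} {ys} u xs< with any? (_∉? xs) ys
    ... | yes some = find some
    ... | no  none = ⊥-elim (<⇒≱ xs< (Unique⇒length≤ u ys⊆xs))
      where
        ys⊆xs : ys ⊆ xs
        ys⊆xs {y} y∈ with y ∈? xs
        ... | yes y∈xs = y∈xs
        ... | no  y∉xs = ⊥-elim (none (Any.map (λ { refl → y∉xs }) y∈))

head-filter-minimum : {A : Set} {R : A → A → Set} {P : A → Set} (P? : Decidable P) {xs : List A} {u : A} →
                      AllPairs R xs → u ∈ xs → P u →
                      ∃[ v ] head (filter P? xs) ≡ just v × v ∈ xs × P v ×
                             (∀ {w} → w ∈ xs → P w → w ≡ v ⊎ R v w)
head-filter-minimum {R = R} {P} P? {xs} sorted u∈ Pu with filter P? xs in eq | ∈-filter⁺ P? u∈ Pu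
... | v ∷ r | _ = v , refl , proj₁ v∈∧Pv , proj₂ v∈∧Pv , least
  where
    v∈∧Pv : v ∈ xs × P v
    v∈∧Pv = ∈-filter⁻ P? (subst (v ∈_) (sym eq) (here refl))
    least : ∀ {w} → w ∈ xs → P w → w ≡ v ⊎ R v w
    least w∈ Pw with subst (AllPairs R) eq (AllPairs.filter⁺ P? sorted) | subst (_ ∈_) eq (∈-filter⁺ P? w∈ Pw)
    ... | _      | here refl = inj₁ refl
    ... | Rv ∷ _ | there w∈r = inj₂ (All.lookup Rv w∈r)

allFin-sorted : (m : ℕ) → AllPairs (λ i j → toℕ i < toℕ j) (allFin m)
allFin-sorted m = AllPairs.tabulate⁺-< id

module Position {A : Set} (_≈ᵇ_ : A → A → Bool)
                (≈ᵇ⇒≡ : ∀ {x y} → T (x ≈ᵇ y) → x ≡ y) (≈ᵇ-refl : ∀ x → T (x ≈ᵇ x)) where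

  pos-< : {x : A} {xs : List A} → x ∈ xs → pos _≈ᵇ_ x xs < length xs
  pos-< {x} {y ∷ ys} x∈ with x ≈ᵇ y in e
  ... | true = s≤s z≤n
  pos-< {x} {y ∷ ys} (here refl)  | false = ⊥-elim (subst T e (≈ᵇ-refl x))
  pos-< {x} {y ∷ ys} (there x∈ys) | false = s≤s (pos-< x∈ys)

  nthOr-pos : (d : A) {x : A} {xs : List A} → x ∈ xs → nthOr d xs (pos _≈ᵇ_ x xs) ≡ x
  nthOr-pos d {x} {y ∷ ys} x∈ with x ≈ᵇ y in e
  ... | true = sym (≈ᵇ⇒≡ (≡-true⇒T e))
  nthOr-pos d {x} {y ∷ ys} (here refl)  | false = ⊥-elim (subst T e (≈ᵇ-refl x))
  nthOr-pos d {x} {y ∷ ys} (there x∈ys) | false = nthOr-pos d x∈ys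

  pos-nthOr : (d : A) {xs : List A} → Unique xs → {k : ℕ} → k < length xs → pos _≈ᵇ_ (nthOr d xs k) xs ≡ k
  pos-nthOr d {xs} u k< = nthOr-injective d u (pos-< x∈) k< (nthOr-pos d x∈)
    where x∈ = nthOr-∈ d xs k<

  pos-injective : {x y : A} {xs : List A} → x ∈ xs → y ∈ xs → pos _≈ᵇ_ x xs ≡ pos _≈ᵇ_ y xs → x ≡ y
  pos-injective {x} {y} {xs} x∈ y∈ e = trans (sym (nthOr-pos x x∈)) (trans (cong (nthOr x xs) e) (nthOr-pos x y∈))

module FinPosition {m : ℕ} = Position (_==_ {m}) ==⇒≡ ==-refl
module ℕPosition = Position _≡ᵇ_ (λ {x} {y} → ≡ᵇ⇒≡ x y) (λ x → ≡⇒≡ᵇ x x refl)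

module _ {A : Set} where

  count-map : {B : Set} (p : B → Bool) (f : A → B) (xs : List A) → count p (map f xs) ≡ count (p ∘ f) xs
  count-map p f []       = refl
  count-map p f (x ∷ xs) with p (f x)
  ... | true  = cong suc (count-map p f xs)
  ... | false = count-map p f xs

  count-cong-∈ : (p q : A → Bool) (xs : List A) → (∀ {x} → x ∈ xs → p x ≡ q x) → count p xs ≡ count q xs
  count-cong-∈ p q []       _   = refl
  count-cong-∈ p q (x ∷ xs) p≡q with p x | q x | p≡q (here refl)
  ... | true  | true  | refl = cong suc (count-cong-∈ p q xs (p≡q ∘ there))
  ... | false | false | refl = count-cong-∈ p q xs (p≡q ∘ there)

  count-↭ : (p : A → Bool) {xs ys : List A} → xs ↭ ys → count p xs ≡ count p ys
  count-↭ p xs↭ys = ↭-length (filter-↭ (T? ∘ p) xs↭ys)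

count-tabulate-cong : {A B : Set} {n : ℕ} (p : A → Bool) (q : B → Bool) (f : Fin n → A) (g : Fin n → B) →
                      (∀ i → p (f i) ≡ q (g i)) → count p (tabulate f) ≡ count q (tabulate g)
count-tabulate-cong {n = zero}  p q f g pf≡qg = refl
count-tabulate-cong {n = suc n} p q f g pf≡qg with p (f zero) | q (g zero) | pf≡qg zero
... | true  | true  | refl = cong suc (count-tabulate-cong p q (f ∘ suc) (g ∘ suc) (pf≡qg ∘ suc))
... | false | false | refl = count-tabulate-cong p q (f ∘ suc) (g ∘ suc) (pf≡qg ∘ suc)

zipWith-tabulate : {A B C : Set} {n : ℕ} (_⊕_ : A → B → C) (f : Fin n → A) (g : Fin n → B) →
                   zipWith _⊕_ (tabulate f) (tabulate g) ≡ tabulate (λ i → f i ⊕ g i)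
zipWith-tabulate {n = zero}  _⊕_ f g = refl
zipWith-tabulate {n = suc n} _⊕_ f g = cong (_ ∷_) (zipWith-tabulate _⊕_ (f ∘ suc) (g ∘ suc))

sum-tabulate-suc : {n : ℕ} (f : Fin n → ℕ) → sum (tabulate (suc ∘ f)) ≡ n + sum (tabulate f)
sum-tabulate-suc {zero}  f = refl
sum-tabulate-suc {suc n} f = cong suc (begin
  f zero + sum (tabulate (suc ∘ f ∘ suc))   ≡⟨ cong (f zero +_) (sum-tabulate-suc (f ∘ suc)) ⟩
  f zero + (n + sum (tabulate (f ∘ suc)))   ≡⟨ x∙yz≈y∙xz (f zero) n _ ⟩
  n + (f zero + sum (tabulate (f ∘ suc)))   ∎)
  where open ≡-Reasoning

allVecs-complete : (m k : ℕ) (v : Vec (Fin m) k) → v ∈ allVecs m k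
allVecs-complete m zero    []      = here refl
allVecs-complete m (suc k) (x ∷ v) =
  ∈-concat⁺′ (∈-map⁺ (x ∷_) (allVecs-complete m k v))
             (∈-map⁺ (λ y → map (y ∷_) (allVecs m k)) (∈-allFin x))

allVecs-unique : (m k : ℕ) → Unique (allVecs m k)
allVecs-unique m zero    = All.[] ∷ []
allVecs-unique m (suc k) = AllPairs.concat⁺
  (All.map⁺ (All.tabulate (λ _ → Unique.map⁺ Vec.∷-injectiveʳ (allVecs-unique m k))))
  (AllPairs.map⁺ (AllPairs.map apart (Unique.allFin⁺ m)))
  where
    apart : ∀ {x y} → x ≢ y →
            All.All (λ u → All.All (u ≢_) (map (y ∷_) (allVecs m k))) (map (x ∷_) (allVecs m k))
    apart x≢y = All.map⁺ (All.tabulate (λ _ → All.map⁺ (All.tabulate (λ _ e → x≢y (Vec.∷-injectiveˡ e)))))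

map↭-of-inverses : {A B : Set} {xs : List A} {ys : List B} (f : A → B) (g : B → A) → Unique xs → Unique ys →
                   (∀ {x} → x ∈ xs → f x ∈ ys) → (∀ {y} → y ∈ ys → g y ∈ xs) →
                   (∀ {x} → x ∈ xs → g (f x) ≡ x) → (∀ {y} → y ∈ ys → f (g y) ≡ y) → map f xs ↭ ys
map↭-of-inverses {xs = xs} {ys} f g uxs uys f∈ g∈ gf fg = ∼bag⇒↭ (unique∧set⇒bag ufxs uys (mk⇔ to from))
  where
    ufxs : Unique (map f xs)
    ufxs = Unique.map⁻ {f = g} (subst Unique (sym (trans (sym (map-∘ xs)) (map-id-local (All.tabulate gf)))) uxs)
    to : ∀ {y} → y ∈ map f xs → y ∈ ys
    to y∈ with x , x∈ , refl ← ∈-map⁻ f y∈ = f∈ x∈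
    from : ∀ {y} → y ∈ ys → y ∈ map f xs
    from y∈ = subst (_∈ map f xs) (fg y∈) (∈-map⁺ f (g∈ y∈))

-- Priority-first search

iter-suc : {A : Set} (k : ℕ) (f : A → A) (a : A) → iter (suc k) f a ≡ f (iter k f a)
iter-suc zero    f a = refl
iter-suc (suc k) f a = iter-suc k f (f a)

Vertex : ℕ → Set
Vertex n = Fin (suc n)

module Search {n : ℕ} (p : Parents n) where

  open FinPosition {suc n}
  open import Data.List.Membership.DecPropositional (Fin._≟_ {suc n}) using (_∈?_)

  par : Vertex n → Vertex n
  par = parent p

  infixl 25 _!_
  _!_ : List (Vertex n) → ℕ → Vertex n
  L ! k = nthOr zero L k

  IsTree : Set
  IsTree = ∀ v → iter n par v ≡ zero

  isTreeᵇ⇔IsTree : T (isTreeᵇ p) ⇔ IsTree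
  isTreeᵇ⇔IsTree = mk⇔ to from
    where
      reachesRoot : Vertex n → Bool
      reachesRoot v = isZero (iter n par v)
      to : T (isTreeᵇ p) → IsTree
      to t v = toℕ-injective (Equivalence.to T-isZero⇔
                 (All.lookup (All.all⁺ reachesRoot (allFin (suc n)) t) (∈-allFin v)))
      from : IsTree → T (isTreeᵇ p)
      from tree = All.all⁻ reachesRoot {allFin (suc n)}
                    (All.tabulate (λ {v} _ → Equivalence.from T-isZero⇔ (cong toℕ (tree v))))

  Frontier : List (Vertex n) → Vertex n → Set
  Frontier vis v = v ∉ vis × par v ∈ vis

  MinFrontier : List (Vertex n) → Vertex n → Set
  MinFrontier vis v = Frontier vis v × (∀ {u} → Frontier vis u → toℕ v ≤ toℕ u)

  MinFrontier-unique : {vis : List (Vertex n)} {v w : Vertex n} → MinFrontier vis v → MinFrontier vis w → v ≡ w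
  MinFrontier-unique (fv , v≤) (fw , w≤) = toℕ-injective (≤-antisym (v≤ fw) (w≤ fv))

  Closed : List (Vertex n) → Set
  Closed vis = ∀ {u} → u ∈ vis → par u ∈ vis

  ancestor-in-frontier : {vis : List (Vertex n)} {v : Vertex n} (t : ℕ) → v ∉ vis → iter t par v ∈ vis →
                         ∃[ s ] s < t × Frontier vis (iter s par v)
  ancestor-in-frontier zero v∉ v∈ = ⊥-elim (v∉ v∈)
  ancestor-in-frontier {vis} {v} (suc t) v∉ ancestor∈ with iter t par v ∈? vis
  ... | no  ∉vis = t , ≤-refl , ∉vis , subst (_∈ vis) (iter-suc t par v) ancestor∈
  ... | yes ∈vis with s , s<t , frontier ← ancestor-in-frontier t v∉ ∈vis = s , m≤n⇒m≤1+n s<t , frontier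

  isFrontierᵇ : List (Vertex n) → Vertex n → Bool
  isFrontierᵇ vis v = not (memᵇ v vis) ∧ any (λ u → adjᵇ p u v) vis

  searchStep-head : (vis : List (Vertex n)) → searchStep p vis ≡ head (filterᵇ (isFrontierᵇ vis) (allFin (suc n)))
  searchStep-head vis with filterᵇ (isFrontierᵇ vis) (allFin (suc n))
  ... | []    = refl
  ... | _ ∷ _ = refl

  isFrontierᵇ⇔Frontier : {vis : List (Vertex n)} {v : Vertex n} → zero ∈ vis → Closed vis →
                         T (isFrontierᵇ vis v) ⇔ Frontier vis v
  isFrontierᵇ⇔Frontier {vis} {v} 0∈ closed = mk⇔ to from
    where
      to : T (isFrontierᵇ vis v) → Frontier vis v
      to t
        with unvisited , adjacent ← Equivalence.to T-∧ t
        with u , u∈ , adj ← find (Any.any⁻ (λ u → adjᵇ p u v) vis adjacent) = v∉ , par∈ (Equivalence.to T-∨ adj)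
        where
          v∉ : v ∉ vis
          v∉ v∈ = T-not⇒¬T unvisited (Equivalence.from memᵇ⇔∈ v∈)
          par∈ : T (not (isZero v) ∧ (par v == u)) ⊎ T (not (isZero u) ∧ (par u == v)) → par v ∈ vis
          par∈ (inj₁ child)  = subst (_∈ vis) (sym (==⇒≡ par≡)) u∈
            where par≡ = proj₂ (Equivalence.to (T-∧ {not (isZero v)}) child)
          par∈ (inj₂ parent) = ⊥-elim (v∉ (subst (_∈ vis) (==⇒≡ par≡) (closed u∈)))
            where par≡ = proj₂ (Equivalence.to (T-∧ {not (isZero u)}) parent)
      from : Frontier vis v → T (isFrontierᵇ vis v)
      from (v∉ , par∈) =
        Equivalence.from T-∧ (unvisited , Any.any⁺ _ (Any.map (λ { refl → adjacent v v∉ }) par∈))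
        where
          unvisited : T (not (memᵇ v vis))
          unvisited = ¬T⇒T-not (v∉ ∘ Equivalence.to memᵇ⇔∈)
          adjacent : (w : Vertex n) → w ∉ vis → T (adjᵇ p (par w) w)
          adjacent zero    w∉ = ⊥-elim (w∉ 0∈)
          adjacent (suc w) _  = Equivalence.from T-∨ (inj₁ (==-refl (par (suc w))))

  searchStep-minimum : {vis : List (Vertex n)} {u : Vertex n} → zero ∈ vis → Closed vis → Frontier vis u →
                       ∃[ v ] searchStep p vis ≡ just v × MinFrontier vis v
  searchStep-minimum {vis} 0∈ closed fu
    with v , eq , _ , Fv , least ← head-filter-minimum (T? ∘ isFrontierᵇ vis) (allFin-sorted (suc n)) (∈-allFin _)
                                     (Equivalence.from (isFrontierᵇ⇔Frontier 0∈ closed) fu) =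
    v , trans (searchStep-head vis) eq , Equivalence.to (isFrontierᵇ⇔Frontier 0∈ closed) Fv ,
    λ fw → minimal (least (∈-allFin _) (Equivalence.from (isFrontierᵇ⇔Frontier 0∈ closed) fw))
    where
      minimal : ∀ {w} → w ≡ v ⊎ toℕ v < toℕ w → toℕ v ≤ toℕ w
      minimal (inj₁ refl) = ≤-refl
      minimal (inj₂ v<w)  = <⇒≤ v<w

  searchStep-≡ : {vis : List (Vertex n)} {v : Vertex n} → zero ∈ vis → Closed vis → MinFrontier vis v →
                 searchStep p vis ≡ just v
  searchStep-≡ 0∈ closed mv with w , eq , mw ← searchStep-minimum 0∈ closed (proj₁ mv) =
    trans eq (cong just (MinFrontier-unique mw mv))

  visit-step : {vis : List (Vertex n)} {v : Vertex n} (r : ℕ) → searchStep p vis ≡ just v →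
               visit (suc r) p vis ≡ visit r p (vis ++ [ v ])
  visit-step {vis} r eq with searchStep p vis
  visit-step r refl | just _ = refl

  record IsSearchOrder (L : List (Vertex n)) : Set where
    field
      nonempty  : 0 < length L
      root      : L ! 0 ≡ zero
      unique    : Unique L
      minimum   : ∀ {k} → 0 < k → k < length L → MinFrontier (take k L) (L ! k)

    root∈take : ∀ {k} → 0 < k → zero ∈ take k L
    root∈take 0<k = subst (_∈ take _ L) root (<⇒nthOr∈take zero L 0<k nonempty)

    take-closed : ∀ k → Closed (take k L)
    take-closed k {u} u∈
      with i , i< , refl ← ∈⇒nthOr zero (∈-take⁻ k L u∈)
      with nthOr∈take⇒< zero unique i< u∈
    ... | i<k with i
    ...   | zero  = subst (λ r → par r ∈ take k L) (sym root) (root∈take i<k)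
    ...   | suc j = take-⊆-take L (<⇒≤ i<k) (proj₂ (proj₁ (minimum (s≤s z≤n) i<)))

    closed : Closed L
    closed = subst Closed (take-all (length L) L ≤-refl) (take-closed (length L))

    root∈ : zero ∈ L
    root∈ = ∈-take⁻ 1 L (root∈take (s≤s z≤n))

  open IsSearchOrder

  searchOrder-visit : {L : List (Vertex n)} → IsSearchOrder L → length L ≡ suc n → weary p ≡ L
  searchOrder-visit {L} so len = subst (λ vis → visit n p vis ≡ L) take1 (go n 1 (s≤s z≤n) refl)
    where
      take1 : take 1 L ≡ [ zero ]
      take1 = trans (take-suc-nthOr zero L (nonempty so)) (cong [_] (root so))
      go : (r k : ℕ) → 0 < k → k + r ≡ suc n → visit r p (take k L) ≡ L
      go zero    k _   k≡ = take-all k L (≤-reflexive (trans len (trans (sym k≡) (+-identityʳ k))))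
      go (suc r) k 0<k k≡ = begin
        visit (suc r) p (take k L)          ≡⟨ visit-step r (searchStep-≡ (root∈take so 0<k) (take-closed so k)
                                                                          (minimum so 0<k k<)) ⟩
        visit r p (take k L ++ [ L ! k ])   ≡⟨ cong (visit r p) (take-suc-nthOr zero L k<) ⟨
        visit r p (take (suc k) L)          ≡⟨ go r (suc k) (s≤s z≤n) (trans (sym (+-suc k r)) k≡) ⟩
        L                                   ∎
        where
          open ≡-Reasoning
          k< : k < length L
          k< = subst (k <_) (sym len) (subst (k <_) k≡ (m<m+n k (s≤s z≤n)))

  searchOrder-∷ʳ : {vis : List (Vertex n)} {w : Vertex n} → IsSearchOrder vis → MinFrontier vis w →
                   IsSearchOrder (vis ++ [ w ])
  searchOrder-∷ʳ {vis} {w} so mw = record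
    { nonempty = <-≤-trans (nonempty so) (length-++-≤ˡ vis)
    ; root     = trans (nthOr-++ˡ zero vis [ w ] (nonempty so)) (root so)
    ; unique   = Unique.++⁺ (unique so) (All.[] ∷ []) (λ { (w∈ , here refl) → proj₁ (proj₁ mw) w∈ })
    ; minimum  = minimum′
    }
    where
      minimum′ : ∀ {k} → 0 < k → k < length (vis ++ [ w ]) →
                 MinFrontier (take k (vis ++ [ w ])) ((vis ++ [ w ]) ! k)
      minimum′ {k} 0<k k< with k <? length vis
      ... | yes k<vis = subst₂ MinFrontier (sym (take-++ˡ vis [ w ] (<⇒≤ k<vis)))
                          (sym (nthOr-++ˡ zero vis [ w ] k<vis)) (minimum so 0<k k<vis)
      ... | no  k≮vis with ≤-antisym (s≤s⁻¹ (subst (k <_) (length-∷ʳ vis w) k<)) (≮⇒≥ k≮vis)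
      ...   | refl = subst₂ MinFrontier (sym (trans (take-++ˡ vis [ w ] ≤-refl) (take-all _ vis ≤-refl)))
                       (sym (nthOr-++-length zero vis [ w ])) mw

  visit-searchOrder : IsTree → {vis : List (Vertex n)} → IsSearchOrder vis → (r : ℕ) → length vis + r ≤ suc n →
                      IsSearchOrder (visit r p vis) × length (visit r p vis) ≡ length vis + r
  visit-searchOrder tree so zero    _  = so , sym (+-identityʳ _)
  visit-searchOrder tree {vis} so (suc r) ≤n =
    extend (Unique-length<⇒missing Fin._≟_ (Unique.allFin⁺ (suc n)) vis<)
    where
      vis< : length vis < length (allFin (suc n))
      vis< = <-≤-trans (m<m+n (length vis) (s≤s z≤n))
                       (subst (length vis + suc r ≤_) (sym (length-tabulate id)) ≤n)
      length-shift : ∀ w → length (vis ++ [ w ]) + r ≡ length vis + suc r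
      length-shift w = trans (cong (_+ r) (length-∷ʳ vis w)) (sym (+-suc (length vis) r))
      extend : ∃[ v ] v ∈ allFin (suc n) × v ∉ vis →
               IsSearchOrder (visit (suc r) p vis) × length (visit (suc r) p vis) ≡ length vis + suc r
      extend (v , _ , v∉)
        with s , _ , frontier ← ancestor-in-frontier n v∉ (subst (_∈ vis) (sym (tree v)) (root∈ so))
        with w , eq , mw ← searchStep-minimum (root∈ so) (closed so) frontier
        with so′ , len′ ← visit-searchOrder tree (searchOrder-∷ʳ so mw) r
                              (subst (_≤ suc n) (sym (length-shift w)) ≤n)
        = subst (λ vis′ → IsSearchOrder vis′ × length vis′ ≡ length vis + suc r) (sym (visit-step r eq))
                (so′ , trans len′ (length-shift w))

  weary-isSearchOrder : IsTree → IsSearchOrder (weary p) × length (weary p) ≡ suc n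
  weary-isSearchOrder tree = visit-searchOrder tree root-only n ≤-refl
    where
      root-only : IsSearchOrder [ zero ]
      root-only = record
        { nonempty = s≤s z≤n ; root = refl ; unique = All.[] ∷ [] ; minimum = λ { (s≤s _) (s≤s ()) } }

  module FullSearchOrder {L : List (Vertex n)} (so : IsSearchOrder L) (len : length L ≡ suc n) where

    position : Vertex n → ℕ
    position v = pos _==_ v L

    <length-L : ∀ {k} → k < suc n → k < length L
    <length-L = subst (_ <_) (sym len)

    ∈L : ∀ v → v ∈ L
    ∈L v = Unique-length≥⇒⊇ Fin._≟_ (unique so) (λ {x} _ → ∈-allFin x)
             (≤-reflexive (trans (length-tabulate id) (sym len))) (∈-allFin v)

    L↭allFin : L ↭ allFin (suc n)
    L↭allFin = ∼bag⇒↭ (unique∧set⇒bag (unique so) (Unique.allFin⁺ (suc n))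
                                        (mk⇔ (λ _ → ∈-allFin _) (λ _ → ∈L _)))

    !-position : ∀ v → L ! position v ≡ v
    !-position v = nthOr-pos zero (∈L v)

    position-< : ∀ v → position v < suc n
    position-< v = subst (position v <_) len (pos-< (∈L v))

    position-! : ∀ {k} → k < suc n → position (L ! k) ≡ k
    position-! k< = pos-nthOr zero (unique so) (<length-L k<)

    position-injective : ∀ {u v} → position u ≡ position v → u ≡ v
    position-injective = pos-injective (∈L _) (∈L _)

    position-root : position zero ≡ 0
    position-root = subst (λ r → position r ≡ 0) (root so) (position-! (s≤s z≤n))

    position-nonroot : ∀ {v} → v ≢ zero → 0 < position v
    position-nonroot {v} v≢0 with position v in e
    ... | zero  = ⊥-elim (v≢0 (position-injective (trans e (sym position-root))))
    ... | suc _ = s≤s z≤n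

    ∈take⇒position< : ∀ {v k} → v ∈ take k L → position v < k
    ∈take⇒position< {v} v∈ =
      nthOr∈take⇒< zero (unique so) (<length-L (position-< v)) (subst (_∈ take _ L) (sym (!-position v)) v∈)

    position<⇒∈take : ∀ {v k} → position v < k → v ∈ take k L
    position<⇒∈take {v} pos< =
      subst (_∈ take _ L) (!-position v) (<⇒nthOr∈take zero L pos< (<length-L (position-< v)))

    minimum-at : ∀ {j u} → 0 < j → j < suc n → Frontier (take j L) u → toℕ (L ! j) ≤ toℕ u
    minimum-at 0<j j< = proj₂ (minimum so 0<j (<length-L j<))

    parent-earlier : ∀ {v} → v ≢ zero → position (par v) < position v
    parent-earlier {v} v≢0 = ∈take⇒position< (subst (λ u → par u ∈ take (position v) L) (!-position v)
      (proj₂ (proj₁ (minimum so (position-nonroot v≢0) (<length-L (position-< v))))))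

    between-parent-and-child : ∀ {v j} → v ≢ zero → position (par v) < j → j ≤ position v →
                               toℕ (L ! j) ≤ toℕ v
    between-parent-and-child {v} {j} v≢0 par< j≤ with j ≟ position v
    ... | yes refl = ≤-reflexive (cong toℕ (!-position v))
    ... | no  j≢   = minimum-at (<-≤-trans (s≤s z≤n) par<) (<-trans (≤∧≢⇒< j≤ j≢) (position-< v))
                       ((λ v∈ → <⇒≱ (∈take⇒position< v∈) j≤) , position<⇒∈take par<)

    position-iter : ∀ t v → position (iter t par v) ≤ position v ∸ t
    position-iter zero    v = ≤-refl
    position-iter (suc t) v rewrite iter-suc t par v with iter t par v Fin.≟ zero
    ... | yes u≡0 rewrite u≡0 | position-root = z≤n
    ... | no  u≢0 = subst (position (par (iter t par v)) ≤_) (pred[m∸n]≡m∸[1+n] (position v) t)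
                      (suc[m]≤n⇒m≤pred[n] (<-≤-trans (parent-earlier u≢0) (position-iter t v)))

    isTree : IsTree
    isTree v = position-injective (trans (n≤0⇒n≡0 root-reached) (sym position-root))
      where
        root-reached : position (iter n par v) ≤ 0
        root-reached = ≤-trans (position-iter n v) (≤-reflexive (m≤n⇒m∸n≡0 (s≤s⁻¹ (position-< v))))

-- Parking

head≡just⇒∈ : {A : Set} {xs : List A} {x : A} → head xs ≡ just x → x ∈ xs
head≡just⇒∈ {xs = _ ∷ _} refl = here refl

∈-spots⇔ : {n j : ℕ} → j ∈ map suc (upTo n) ⇔ (0 < j × j ≤ n)
∈-spots⇔ {n} {j} = mk⇔ to from
  where
    to : j ∈ map suc (upTo n) → 0 < j × j ≤ n
    to j∈ with i , i∈ , refl ← ∈-map⁻ suc j∈ = s≤s z≤n , ∈-upTo⁻ i∈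
    from : 0 < j × j ≤ n → j ∈ map suc (upTo n)
    from (s≤s _ , j≤n) = ∈-map⁺ suc (∈-upTo⁺ j≤n)

spots-sorted : (n : ℕ) → AllPairs _<_ (map suc (upTo n))
spots-sorted n = AllPairs.map⁺ (AllPairs.applyUpTo⁺₁ id n (λ i<j _ → s≤s i<j))

Available : ℕ → ℕ → List ℕ → ℕ → Set
Available n a occ j = (0 < j × j ≤ n) × a ≤ j × j ∉ occ

FirstFree : ℕ → ℕ → List ℕ → ℕ → Set
FirstFree n a occ j = Available n a occ j × (∀ {j′} → Available n a occ j′ → j ≤ j′)

module _ {n a : ℕ} {occ : List ℕ} where

  isAvailableᵇ : ℕ → Bool
  isAvailableᵇ j = (a ≤ᵇ j) ∧ not (any (j ≡ᵇ_) occ)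

  private
    T-any≡ᵇ⇔∈ : ∀ {j} → T (any (j ≡ᵇ_) occ) ⇔ j ∈ occ
    T-any≡ᵇ⇔∈ {j} = mk⇔
      (λ t → Any.map (≡ᵇ⇒≡ j _) (Any.any⁻ (j ≡ᵇ_) occ t))
      (λ j∈ → Any.any⁺ (j ≡ᵇ_) (Any.map (≡⇒≡ᵇ j _) j∈))

  isAvailableᵇ⇔ : ∀ {j} → (j ∈ map suc (upTo n) × T (isAvailableᵇ j)) ⇔ Available n a occ j
  isAvailableᵇ⇔ {j} = mk⇔ to from
    where
      to : j ∈ map suc (upTo n) × T (isAvailableᵇ j) → Available n a occ j
      to (j∈ , t) with a≤j , free ← Equivalence.to T-∧ t =
        Equivalence.to ∈-spots⇔ j∈ , ≤ᵇ⇒≤ a j a≤j , T-not⇒¬T free ∘ Equivalence.from T-any≡ᵇ⇔∈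
      from : Available n a occ j → j ∈ map suc (upTo n) × T (isAvailableᵇ j)
      from (range , a≤j , j∉) =
        Equivalence.from ∈-spots⇔ range ,
        Equivalence.from T-∧ (≤⇒≤ᵇ a≤j , ¬T⇒T-not (j∉ ∘ Equivalence.to T-any≡ᵇ⇔∈))

  firstFree-head : firstFree n a occ ≡ head (filterᵇ isAvailableᵇ (map suc (upTo n)))
  firstFree-head with filterᵇ isAvailableᵇ (map suc (upTo n))
  ... | []    = refl
  ... | _ ∷ _ = refl

  firstFree-minimum : ∀ {u} → Available n a occ u → ∃[ j ] firstFree n a occ ≡ just j × FirstFree n a occ j
  firstFree-minimum avail
    with j∈ , t ← Equivalence.from isAvailableᵇ⇔ avail
    with j , eq , j∈′ , t′ , least ← head-filter-minimum (T? ∘ isAvailableᵇ) (spots-sorted n) j∈ t =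
    j , trans firstFree-head eq , Equivalence.to isAvailableᵇ⇔ (j∈′ , t′) , minimal
    where
      minimal : ∀ {j′} → Available n a occ j′ → j ≤ j′
      minimal avail′ with j∈″ , t″ ← Equivalence.from isAvailableᵇ⇔ avail′ with least j∈″ t″
      ... | inj₁ refl = ≤-refl
      ... | inj₂ j<j′ = <⇒≤ j<j′

  firstFree≡just⇔FirstFree : ∀ {j} → firstFree n a occ ≡ just j ⇔ FirstFree n a occ j
  firstFree≡just⇔FirstFree {j} = mk⇔ to from
    where
      to : firstFree n a occ ≡ just j → FirstFree n a occ j
      to eq with j∈ , t ← ∈-filter⁻ (T? ∘ isAvailableᵇ) (head≡just⇒∈ (trans (sym firstFree-head) eq))
            with j′ , eq′ , first ← firstFree-minimum (Equivalence.to isAvailableᵇ⇔ (j∈ , t))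
            with refl ← trans (sym eq) eq′ = first
      from : FirstFree n a occ j → firstFree n a occ ≡ just j
      from (avail , least) with j′ , eq , (avail′ , least′) ← firstFree-minimum avail =
        trans eq (cong just (≤-antisym (least′ avail) (least avail′)))

Parks : ℕ → List ℕ → List ℕ → List ℕ → Set
Parks n occ as S = length S ≡ length as ×
                   (∀ {c} → c < length as → FirstFree n (nthOr 0 as c) (occ ++ take c S) (nthOr 0 S c))

parkFrom-step : {n a j : ℕ} (occ as : List ℕ) → firstFree n a occ ≡ just j →
                parkFrom n occ (a ∷ as) ≡ parkFrom n (occ ++ [ j ]) as
parkFrom-step {n} {a} occ as eq with firstFree n a occ
parkFrom-step occ as refl | just _ = refl

parkFrom≡just⇒Parks : (n : ℕ) (occ as : List ℕ) {R : List ℕ} → parkFrom n occ as ≡ just R →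
                      ∃[ S ] R ≡ occ ++ S × Parks n occ as S
parkFrom≡just⇒Parks n occ []       refl = [] , sym (++-identityʳ occ) , refl , λ ()
parkFrom≡just⇒Parks n occ (a ∷ as) eq with firstFree n a occ in ff
parkFrom≡just⇒Parks n occ (a ∷ as) eq | just j
  with S , refl , len , first ← parkFrom≡just⇒Parks n (occ ++ [ j ]) as eq =
  j ∷ S , ++-assoc occ [ j ] S , cong suc len , first′
  where
    first′ : ∀ {c} → c < length (a ∷ as) →
             FirstFree n (nthOr 0 (a ∷ as) c) (occ ++ take c (j ∷ S)) (nthOr 0 (j ∷ S) c)
    first′ {zero}  _        = subst (λ o → FirstFree n a o j) (sym (++-identityʳ occ))
                                    (Equivalence.to firstFree≡just⇔FirstFree ff)
    first′ {suc c} (s≤s c<) = subst (λ o → FirstFree n (nthOr 0 as c) o (nthOr 0 S c)) (++-assoc occ [ j ] (take c S))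
                                    (first c<)

Parks⇒parkFrom≡just : (n : ℕ) (occ as S : List ℕ) → Parks n occ as S → parkFrom n occ as ≡ just (occ ++ S)
Parks⇒parkFrom≡just n occ []       []      _             = cong just (sym (++-identityʳ occ))
Parks⇒parkFrom≡just n occ (a ∷ as) (j ∷ S) (len , first) = begin
  parkFrom n occ (a ∷ as)       ≡⟨ parkFrom-step {n} {a} occ as (Equivalence.from firstFree≡just⇔FirstFree first₀) ⟩
  parkFrom n (occ ++ [ j ]) as  ≡⟨ Parks⇒parkFrom≡just n (occ ++ [ j ]) as S (suc-injective len , first′) ⟩
  just ((occ ++ [ j ]) ++ S)    ≡⟨ cong just (++-assoc occ [ j ] S) ⟩
  just (occ ++ j ∷ S)           ∎
  where
    open ≡-Reasoning
    first₀ : FirstFree n a occ j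
    first₀ = subst (λ o → FirstFree n a o j) (++-identityʳ occ) (first (s≤s z≤n))
    first′ : ∀ {c} → c < length as → FirstFree n (nthOr 0 as c) ((occ ++ [ j ]) ++ take c S) (nthOr 0 S c)
    first′ {c} c< = subst (λ o → FirstFree n (nthOr 0 as c) o (nthOr 0 S c)) (sym (++-assoc occ [ j ] (take c S)))
                          (first (s≤s c<))

-- Left-to-right maxima

LeftToRightMaxAbove : ℕ → ℕ → List ℕ → Set
LeftToRightMaxAbove m x xs =
  ∃[ k ] k < length xs × nthOr 0 xs k ≡ x × m < x × (∀ {j} → j < k → nthOr 0 xs j < x)

lrMaxFrom⇒ : (m x : ℕ) (xs : List ℕ) → T (any (x ≡ᵇ_) (lrMaxFrom m xs)) → LeftToRightMaxAbove m x xs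
lrMaxFrom⇒ m x (y ∷ ys) t with m <ᵇ y in m<y
... | false with k , k< , kx , m<x , before ← lrMaxFrom⇒ m x ys t =
  suc k , s≤s k< , kx , m<x ,
  λ { {zero} _ → ≤-<-trans (≮⇒≥ (λ m<y′ → subst T m<y (<⇒<ᵇ m<y′))) m<x ; {suc j} (s≤s j<) → before j< }
... | true with x ≡ᵇ y in x≡y
...   | true  = 0 , s≤s z≤n , sym x≡y′ , subst (m <_) (sym x≡y′) (<ᵇ⇒< m y (≡-true⇒T m<y)) , λ ()
  where x≡y′ = ≡ᵇ⇒≡ x y (≡-true⇒T x≡y)
...   | false with k , k< , kx , y<x , before ← lrMaxFrom⇒ y x ys t =
  suc k , s≤s k< , kx , <-trans (<ᵇ⇒< m y (≡-true⇒T m<y)) y<x ,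
  λ { {zero} _ → y<x ; {suc j} (s≤s j<) → before j< }

lrMaxFrom⇐ : (m x : ℕ) (xs : List ℕ) → LeftToRightMaxAbove m x xs → T (any (x ≡ᵇ_) (lrMaxFrom m xs))
lrMaxFrom⇐ m x (y ∷ ys) (zero , _ , refl , m<y , _) with m <ᵇ y | <⇒<ᵇ m<y
... | true | _ = Equivalence.from T-∨ (inj₁ (≡⇒≡ᵇ y y refl))
lrMaxFrom⇐ m x (y ∷ ys) (suc k , s≤s k< , kx , m<x , before) with m <ᵇ y
... | true  = Equivalence.from (T-∨ {x ≡ᵇ y})
                (inj₂ (lrMaxFrom⇐ y x ys (k , k< , kx , before {0} (s≤s z≤n) , before ∘ s≤s)))
... | false = lrMaxFrom⇐ m x ys (k , k< , kx , m<x , before ∘ s≤s)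

lrMaxFrom⇔ : (m x : ℕ) (xs : List ℕ) → T (any (x ≡ᵇ_) (lrMaxFrom m xs)) ⇔ LeftToRightMaxAbove m x xs
lrMaxFrom⇔ m x xs = mk⇔ (lrMaxFrom⇒ m x xs) (lrMaxFrom⇐ m x xs)

-- The bijection between trees and parking functions

prefs-tabulate : {n : ℕ} (a : Vec (Fin n) n) → prefs a ≡ tabulate (λ i → suc (toℕ (lookup a i)))
prefs-tabulate a = trans (cong (map (suc ∘ toℕ)) (toList≡tabulate-lookup a)) (map-tabulate (lookup a) (suc ∘ toℕ))

-- For a tree, weary⁻¹ p (lookup p i) < n (Forward.parent-position<), so the default i is never used.
toPF : {n : ℕ} → Parents n → Vec (Fin n) n
toPF p = Vec.tabulate (λ i → fromℕ-or (weary⁻¹ p (lookup p i)) i)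

-- Position 0 holds the root and position j ≥ 1 the car parked in spot j; car c is vertex c.
searchWord : {n : ℕ} → Vec (Fin n) n → List (Vertex n)
searchWord a = zero ∷ map (λ c → fromℕ-or c zero) (carWord a)

toTree : {n : ℕ} → Vec (Fin n) n → Parents n
toTree a = Vec.tabulate (λ i → nthOr zero (searchWord a) (toℕ (lookup a i)))

module Forward {n : ℕ} (p : Parents n) (p-tree : T (isTreeᵇ p)) where

  open Search p public

  private
    weary-order = weary-isSearchOrder (Equivalence.to isTreeᵇ⇔IsTree p-tree)

  L : List (Vertex n)
  L = weary p

  open FullSearchOrder (proj₁ weary-order) (proj₂ weary-order) public

  parent-position< : (i : Fin n) → position (lookup p i) < n
  parent-position< i = <-≤-trans (parent-earlier {suc i} (λ ())) (s≤s⁻¹ (position-< (suc i)))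

  toℕ-toPF : (i : Fin n) → toℕ (lookup (toPF p) i) ≡ position (lookup p i)
  toℕ-toPF i = trans (cong toℕ (Vec.lookup∘tabulate _ i)) (toℕ-fromℕ-or (parent-position< i))

  preferences : List ℕ
  preferences = tabulate (λ i → suc (position (lookup p i)))

  prefs-toPF : prefs (toPF p) ≡ preferences
  prefs-toPF = trans (prefs-tabulate (toPF p)) (tabulate-cong (cong suc ∘ toℕ-toPF))

  parkingSpots : List ℕ
  parkingSpots = tabulate (λ i → position (suc i))

  parkingSpots-unique : Unique parkingSpots
  parkingSpots-unique = Unique.tabulate⁺ (Fin.suc-injective ∘ position-injective)

  !-nonroot : ∀ {j} → 0 < j → j < suc n → ∃[ d ] L ! j ≡ suc d
  !-nonroot {j} 0<j j< with L ! j in e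
  ... | zero  = ⊥-elim (<-irrefl (trans (sym position-root) (trans (cong position (sym e)) (position-! j<))) 0<j)
  ... | suc d = d , refl

  parks-at-position : (i : Fin n) →
                      FirstFree n (suc (position (lookup p i))) (take (toℕ i) parkingSpots) (position (suc i))
  parks-at-position i = ((position-nonroot (λ ()) , s≤s⁻¹ (position-< v)) , parent-earlier (λ ()) , free) , least
    where
      v = suc i
      free : position v ∉ take (toℕ i) parkingSpots
      free v∈
        with d , d<i , e ← ∈-take-tabulate⁻ _ (toℕ i) v∈
        with refl ← position-injective e = <-irrefl refl d<i
      -- A free spot j before position v would be the position of a vertex searched between v's
      -- parent and v, hence smaller than v: an earlier car, which occupies j.
      least : ∀ {j} → Available n (suc (position (lookup p i))) (take (toℕ i) parkingSpots) j → position v ≤ j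
      least {j} ((0<j , j≤n) , par< , j∉) with position v ≤? j
      ... | yes pos≤j = pos≤j
      ... | no  pos≰j with d , e ← !-nonroot 0<j (s≤s j≤n) =
        ⊥-elim (j∉ (subst (_∈ take (toℕ i) parkingSpots) j≡ (∈-take-tabulate⁺ _ d d<i)))
        where
          j<pos : j < position v
          j<pos = ≰⇒> pos≰j
          j≡ : position (suc d) ≡ j
          j≡ = trans (cong position (sym e)) (position-! (s≤s j≤n))
          d≤i : toℕ (suc d) ≤ toℕ v
          d≤i = subst (λ u → toℕ u ≤ toℕ v) e (between-parent-and-child (λ ()) par< (<⇒≤ j<pos))
          d<i : toℕ d < toℕ i
          d<i = s≤s⁻¹ (≤∧≢⇒< d≤i (λ d≡i → <-irrefl (trans (sym j≡) (cong position (toℕ-injective d≡i))) j<pos))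

  parks : Parks n [] preferences parkingSpots
  parks = trans (length-tabulate (position ∘ suc)) (sym (length-tabulate (suc ∘ position ∘ lookup p))) , first
    where
      first : ∀ {c} → c < length preferences →
              FirstFree n (nthOr 0 preferences c) (take c parkingSpots) (nthOr 0 parkingSpots c)
      first c< = ∀Fin⇒∀< (λ i → subst₂ (λ a j → FirstFree n a (take (toℕ i) parkingSpots) j)
                                  (sym (nthOr-tabulate 0 _ i)) (sym (nthOr-tabulate 0 _ i)) (parks-at-position i))
                         (subst (_ <_) (length-tabulate (suc ∘ position ∘ lookup p)) c<)

  parkFrom-toPF : parkFrom n [] (prefs (toPF p)) ≡ just parkingSpots
  parkFrom-toPF = trans (cong (parkFrom n []) prefs-toPF) (Parks⇒parkFrom≡just n [] preferences parkingSpots parks)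

  toPF-isPF : T (isPFᵇ (toPF p))
  toPF-isPF = subst (T ∘ is-just) (sym parkFrom-toPF) tt

  spots-toPF : spots (toPF p) ≡ parkingSpots
  spots-toPF = cong (fromMaybe []) parkFrom-toPF

  nonrootLabels : List ℕ
  nonrootLabels = map (λ j → toℕ (L ! j)) (map suc (upTo n))

  length-nonrootLabels : length nonrootLabels ≡ n
  length-nonrootLabels =
    trans (length-map _ (map suc (upTo n))) (trans (length-map suc (upTo n)) (length-applyUpTo id n))

  nonrootLabels-! : ∀ {k} → k < n → nthOr 0 nonrootLabels k ≡ toℕ (L ! suc k)
  nonrootLabels-! {k} k< =
    trans (cong (λ xs → nthOr 0 xs k) (sym (map-∘ (upTo n)))) (nthOr-map-upTo 0 (λ j → toℕ (L ! suc j)) k<)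

  carWord-toPF : carWord (toPF p) ≡ nonrootLabels
  carWord-toPF = trans (cong (λ S → map (λ j → suc (pos _≡ᵇ_ j S)) (map suc (upTo n))) spots-toPF)
                       (map-cong-local (All.tabulate car-at))
    where
      car-at : ∀ {j} → j ∈ map suc (upTo n) → suc (pos _≡ᵇ_ j parkingSpots) ≡ toℕ (L ! j)
      car-at {j} j∈
        with 0<j , j≤n ← Equivalence.to ∈-spots⇔ j∈
        with d , e ← !-nonroot 0<j (s≤s j≤n) = begin
        suc (pos _≡ᵇ_ j parkingSpots)
          ≡⟨ cong (λ k → suc (pos _≡ᵇ_ k parkingSpots)) spot-d ⟨
        suc (pos _≡ᵇ_ (nthOr 0 parkingSpots (toℕ d)) parkingSpots)
          ≡⟨ cong suc (ℕPosition.pos-nthOr 0 parkingSpots-unique d<) ⟩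
        suc (toℕ d)
          ≡⟨ cong toℕ e ⟨
        toℕ (L ! j) ∎
        where
          open ≡-Reasoning
          spot-d : nthOr 0 parkingSpots (toℕ d) ≡ j
          spot-d = trans (nthOr-tabulate 0 _ d) (trans (cong position (sym e)) (position-! (s≤s j≤n)))
          d< : toℕ d < length parkingSpots
          d< = subst (toℕ d <_) (sym (length-tabulate (position ∘ suc))) (toℕ<n d)

  L≡map-! : L ≡ map (L !_) (upTo (suc n))
  L≡map-! = trans (sym (map-nthOr-upTo zero L)) (cong (λ k → map (L !_) (upTo k)) (proj₂ weary-order))

  L≡root∷nonroot : L ≡ zero ∷ map (L !_) (map suc (upTo n))
  L≡root∷nonroot = trans L≡map-! (trans (cong (map (L !_)) (upTo-suc n))
                     (cong (λ r → r ∷ map (L !_) (map suc (upTo n))) (IsSearchOrder.root (proj₁ weary-order))))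

  searchWord-toPF : searchWord (toPF p) ≡ L
  searchWord-toPF = begin
    zero ∷ map (λ c → fromℕ-or c zero) (carWord (toPF p))
      ≡⟨ cong (λ w → zero ∷ map (λ c → fromℕ-or c zero) w) carWord-toPF ⟩
    zero ∷ map (λ c → fromℕ-or c zero) (map (λ j → toℕ (L ! j)) (map suc (upTo n)))
      ≡⟨ cong (zero ∷_) (trans (sym (map-∘ _)) (map-cong (λ j → fromℕ-or-toℕ (L ! j) zero) _)) ⟩
    zero ∷ map (L !_) (map suc (upTo n))
      ≡⟨ L≡root∷nonroot ⟨
    L ∎
    where open ≡-Reasoning

  toTree-toPF : toTree (toPF p) ≡ p
  toTree-toPF = trans (Vec.tabulate-cong parent-at) (Vec.tabulate∘lookup p)
    where
      parent-at : ∀ i → nthOr zero (searchWord (toPF p)) (toℕ (lookup (toPF p) i)) ≡ lookup p i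
      parent-at i = trans (cong₂ _!_ searchWord-toPF (toℕ-toPF i)) (!-position (lookup p i))

module Backward {n : ℕ} (a : Vec (Fin n) n) (a-pf : T (isPFᵇ a)) where

  S : List ℕ
  S = spots a

  spots-parks : Parks n [] (prefs a) S
  spots-parks
    with R , parked ← T-is-just⇒ a-pf
    with S′ , R≡S′ , parks ← parkFrom≡just⇒Parks n [] (prefs a) parked =
    subst (Parks n [] (prefs a)) (sym (trans (cong (fromMaybe []) parked) R≡S′)) parks

  length-prefs : length (prefs a) ≡ n
  length-prefs = trans (cong length (prefs-tabulate a)) (length-tabulate _)

  length-S : length S ≡ n
  length-S = trans (proj₁ spots-parks) length-prefs

  spot : Fin n → ℕ
  spot c = nthOr 0 S (toℕ c)

  first-free : ∀ {c} → c < n → FirstFree n (nthOr 0 (prefs a) c) (take c S) (nthOr 0 S c)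
  first-free c< = proj₂ spots-parks (subst (_ <_) (sym length-prefs) c<)

  car-first-free : (c : Fin n) → FirstFree n (suc (toℕ (lookup a c))) (take (toℕ c) S) (spot c)
  car-first-free c = subst (λ pref → FirstFree n pref (take (toℕ c) S) (spot c))
                       (trans (cong (λ ps → nthOr 0 ps (toℕ c)) (prefs-tabulate a)) (nthOr-tabulate 0 _ c))
                       (first-free (toℕ<n c))

  S-unique : Unique S
  S-unique = fresh⇒Unique 0 S (λ c< → proj₂ (proj₂ (proj₁ (first-free (subst (_ <_) length-S c<)))))

  S-range : ∀ {j} → j ∈ S → j ∈ map suc (upTo n)
  S-range j∈ with c , c< , refl ← ∈⇒nthOr 0 j∈ =
    Equivalence.from ∈-spots⇔ (proj₁ (proj₁ (first-free (subst (_ <_) length-S c<))))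

  S-complete : ∀ {j} → j ∈ map suc (upTo n) → j ∈ S
  S-complete = Unique-length≥⇒⊇ _≟_ S-unique S-range
                 (≤-reflexive (trans (length-map suc (upTo n)) (trans (length-applyUpTo id n) (sym length-S))))

  open ℕPosition

  carAt : ℕ → ℕ
  carAt j = pos _≡ᵇ_ j S

  carAt-< : ∀ {j} → 0 < j → j ≤ n → carAt j < n
  carAt-< {j} 0<j j≤n =
    subst (carAt j <_) length-S (pos-< (S-complete (Equivalence.from ∈-spots⇔ (0<j , j≤n))))

  spot-carAt : ∀ {j} → 0 < j → j ≤ n → nthOr 0 S (carAt j) ≡ j
  spot-carAt 0<j j≤n = nthOr-pos 0 (S-complete (Equivalence.from ∈-spots⇔ (0<j , j≤n)))

  carAt-spot : (c : Fin n) → carAt (spot c) ≡ toℕ c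
  carAt-spot c = pos-nthOr 0 S-unique (subst (_ <_) (sym length-S) (toℕ<n c))

  open Search (toTree a)

  L′ : List (Vertex n)
  L′ = searchWord a

  length-L′ : length L′ ≡ suc n
  length-L′ = cong suc (trans (length-map _ (carWord a)) (trans (length-map _ (map suc (upTo n)))
                (trans (length-map suc (upTo n)) (length-applyUpTo id n))))

  searchWord-at : ∀ {j} → 0 < j → j ≤ n → ∃[ c ] L′ ! j ≡ suc c × spot c ≡ j
  searchWord-at {suc k} 0<j j≤n =
    c , toℕ-injective toℕ-L′ , trans (cong (nthOr 0 S) (toℕ-fromℕ< c<)) (spot-carAt 0<j j≤n)
    where
      c< = carAt-< 0<j j≤n
      c = fromℕ< c<
      toℕ-L′ : toℕ (L′ ! suc k) ≡ suc (toℕ c)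
      toℕ-L′ = begin
        toℕ (nthOr zero (map (λ c → fromℕ-or c zero) (map (λ j → suc (carAt j)) (map suc (upTo n)))) k)
          ≡⟨ cong (λ xs → toℕ (nthOr zero xs k)) (trans (sym (map-∘ _)) (sym (map-∘ (upTo n)))) ⟩
        toℕ (nthOr zero (map (λ j → fromℕ-or {suc n} (suc (carAt (suc j))) zero) (upTo n)) k)
          ≡⟨ cong toℕ (nthOr-map-upTo zero (λ j → fromℕ-or (suc (carAt (suc j))) zero) j≤n) ⟩
        toℕ (fromℕ-or {suc n} (suc (carAt (suc k))) zero)
          ≡⟨ toℕ-fromℕ-or (s≤s c<) ⟩
        suc (carAt (suc k))
          ≡⟨ cong suc (toℕ-fromℕ< c<) ⟨
        suc (toℕ c) ∎
        where open ≡-Reasoning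

  spot-range : (c : Fin n) → 0 < spot c × spot c ≤ n
  spot-range c = proj₁ (proj₁ (car-first-free c))

  searchWord-spot : (c : Fin n) → L′ ! spot c ≡ suc c
  searchWord-spot c with c′ , e , spot-c′ ← searchWord-at (proj₁ (spot-range c)) (proj₂ (spot-range c)) =
    trans e (cong suc (toℕ-injective (trans (sym (carAt-spot c′)) (trans (cong carAt spot-c′) (carAt-spot c)))))

  spotOf : Vertex n → ℕ
  spotOf zero    = 0
  spotOf (suc c) = spot c

  spotOf-< : ∀ v → spotOf v < length L′
  spotOf-< zero    = subst (0 <_) (sym length-L′) (s≤s z≤n)
  spotOf-< (suc c) = subst (spot c <_) (sym length-L′) (s≤s (proj₂ (spot-range c)))

  !-spotOf : ∀ v → L′ ! spotOf v ≡ v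
  !-spotOf zero    = refl
  !-spotOf (suc c) = searchWord-spot c

  spotOf-! : ∀ {j} → j < length L′ → spotOf (L′ ! j) ≡ j
  spotOf-! {zero}  _  = refl
  spotOf-! {suc k} j< with c , e , spot-c ← searchWord-at (s≤s z≤n) (s≤s⁻¹ (subst (suc k <_) length-L′ j<)) =
    trans (cong spotOf e) spot-c

  ∈take⇒spotOf< : ∀ {v k} → v ∈ take k L′ → spotOf v < k
  ∈take⇒spotOf< = retraction-∈take⇒< zero spotOf L′ spotOf-!

  spotOf<⇒∈take : ∀ {v k} → spotOf v < k → v ∈ take k L′
  spotOf<⇒∈take {v} sp< = subst (_∈ take _ L′) (!-spotOf v) (<⇒nthOr∈take zero L′ sp< (spotOf-< v))

  spotOf-parent : (c : Fin n) → spotOf (par (suc c)) ≡ toℕ (lookup a c)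
  spotOf-parent c = trans (cong spotOf (Vec.lookup∘tabulate _ c)) (spotOf-! (subst (toℕ (lookup a c) <_) (sym length-L′)
                                                                              (<-trans (toℕ<n (lookup a c)) (n<1+n n))))

  minFrontier-at : ∀ {k} → 0 < k → k ≤ n → MinFrontier (take k L′) (L′ ! k)
  minFrontier-at {k} 0<k k≤n with c , e , spot-c ← searchWord-at 0<k k≤n =
    subst (MinFrontier (take k L′)) (sym e) ((unvisited , parent-visited) , least)
    where
      unvisited : suc c ∉ take k L′
      unvisited c∈ = <-irrefl spot-c (∈take⇒spotOf< c∈)
      parent-visited : par (suc c) ∈ take k L′
      parent-visited =
        spotOf<⇒∈take (subst₂ _<_ (sym (spotOf-parent c)) spot-c (proj₁ (proj₂ (proj₁ (car-first-free c)))))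
      -- A car c′ < c in the frontier prefers a spot ≤ k and found spot k (taken later by c) free,
      -- so it would have parked there.
      least : ∀ {u} → Frontier (take k L′) u → toℕ (suc c) ≤ toℕ u
      least {zero}   (u∉ , _)    = ⊥-elim (u∉ (spotOf<⇒∈take 0<k))
      least {suc c′} (u∉ , par∈) with toℕ c ≤? toℕ c′
      ... | yes c≤c′ = s≤s c≤c′
      ... | no  c≰c′ = ⊥-elim (<-irrefl (cong toℕ c′≡c) c′<c)
        where
          c′<c : toℕ c′ < toℕ c
          c′<c = ≰⇒> c≰c′
          k≤spot : k ≤ spot c′
          k≤spot = ≮⇒≥ (λ spot< → u∉ (spotOf<⇒∈take spot<))
          k-free : k ∉ take (toℕ c′) S
          k-free k∈ = <⇒≱ (nthOr∈take⇒< 0 S-unique (subst (toℕ c <_) (sym length-S) (toℕ<n c))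
                                                     (subst (_∈ take (toℕ c′) S) (sym spot-c) k∈))
                          (<⇒≤ c′<c)
          available : Available n (suc (toℕ (lookup a c′))) (take (toℕ c′) S) k
          available = (0<k , k≤n) , subst (_< k) (spotOf-parent c′) (∈take⇒spotOf< par∈) , k-free
          spot-c′≡spot-c : spot c′ ≡ spot c
          spot-c′≡spot-c = trans (≤-antisym (proj₂ (car-first-free c′) available) k≤spot) (sym spot-c)
          c′≡c : c′ ≡ c
          c′≡c = toℕ-injective (trans (sym (carAt-spot c′)) (trans (cong carAt spot-c′≡spot-c) (carAt-spot c)))

  searchWord-isSearchOrder : IsSearchOrder L′
  searchWord-isSearchOrder = record
    { nonempty = s≤s z≤n
    ; root     = refl
    ; unique   = retraction⇒Unique zero spotOf L′ spotOf-!
    ; minimum  = λ {k} 0<k k< → minFrontier-at 0<k (s≤s⁻¹ (subst (k <_) length-L′ k<))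
    }

  open FullSearchOrder searchWord-isSearchOrder length-L′

  toTree-isTree : T (isTreeᵇ (toTree a))
  toTree-isTree = Equivalence.from isTreeᵇ⇔IsTree isTree

  toPF-toTree : toPF (toTree a) ≡ a
  toPF-toTree = trans (Vec.tabulate-cong preference-at) (Vec.tabulate∘lookup a)
    where
      weary-toTree : weary (toTree a) ≡ L′
      weary-toTree = searchOrder-visit searchWord-isSearchOrder length-L′
      preference-at : ∀ i → fromℕ-or (weary⁻¹ (toTree a) (lookup (toTree a) i)) i ≡ lookup a i
      preference-at i = begin
        fromℕ-or (pos _==_ (lookup (toTree a) i) (weary (toTree a))) i
          ≡⟨ cong (λ L → fromℕ-or (pos _==_ (lookup (toTree a) i) L) i) weary-toTree ⟩
        fromℕ-or (position (lookup (toTree a) i)) i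
          ≡⟨ cong (λ v → fromℕ-or (position v) i) (Vec.lookup∘tabulate _ i) ⟩
        fromℕ-or (position (L′ ! toℕ (lookup a i))) i
          ≡⟨ cong (λ k → fromℕ-or k i) (position-! (<-trans (toℕ<n (lookup a i)) (n<1+n n))) ⟩
        fromℕ-or (toℕ (lookup a i)) i
          ≡⟨ fromℕ-or-toℕ (lookup a i) i ⟩
        lookup a i ∎
        where open ≡-Reasoning

-- Statistics

module Statistics {n : ℕ} (p : Parents n) (p-tree : T (isTreeᵇ p)) where

  open Forward p p-tree

  nonroot↭ : map (L !_) (map suc (upTo n)) ↭ tabulate suc
  nonroot↭ = drop-∷ (subst (_↭ allFin (suc n)) L≡root∷nonroot L↭allFin)

  position-!-nonroot : ∀ {i} → i ∈ map suc (upTo n) → position (L ! i) ≡ i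
  position-!-nonroot i∈ = position-! (s≤s (proj₂ (Equivalence.to ∈-spots⇔ i∈)))

  displacement : Vertex n → ℕ
  displacement v = position v ∸ position (par v)

  wait≡sum-displacement : wait p ≡ sum (tabulate (displacement ∘ suc))
  wait≡sum-displacement = begin
    sum (map (λ ij → proj₁ ij ∸ proj₂ ij) (map (λ i → i , position (par (L ! i))) (map suc (upTo n))))
      ≡⟨ cong sum (map-∘ (map suc (upTo n))) ⟨
    sum (map (λ i → i ∸ position (par (L ! i))) (map suc (upTo n)))
      ≡⟨ cong sum (map-cong-local (All.tabulate (λ {i} i∈ → cong (_∸ position (par (L ! i)))
                                                                 (sym (position-!-nonroot i∈))))) ⟩
    sum (map (displacement ∘ (L !_)) (map suc (upTo n)))
      ≡⟨ cong sum (map-∘ (map suc (upTo n))) ⟩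
    sum (map displacement (map (L !_) (map suc (upTo n))))
      ≡⟨ sum-↭ (map⁺ displacement nonroot↭) ⟩
    sum (map displacement (tabulate suc))
      ≡⟨ cong sum (map-tabulate suc displacement) ⟩
    sum (tabulate (displacement ∘ suc)) ∎
    where open ≡-Reasoning

  probes≡sum-displacement : probes (toPF p) ≡ sum (tabulate (displacement ∘ suc))
  probes≡sum-displacement = begin
    n + sum (zipWith _∸_ (spots (toPF p)) (prefs (toPF p)))
      ≡⟨ cong₂ (λ S P → n + sum (zipWith _∸_ S P)) spots-toPF prefs-toPF ⟩
    n + sum (zipWith _∸_ parkingSpots preferences)
      ≡⟨ cong (λ xs → n + sum xs) (zipWith-tabulate _∸_ (position ∘ suc) (suc ∘ position ∘ lookup p)) ⟩
    n + sum (tabulate (λ i → position (suc i) ∸ suc (position (lookup p i))))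
      ≡⟨ sum-tabulate-suc (λ i → position (suc i) ∸ suc (position (lookup p i))) ⟨
    sum (tabulate (λ i → suc (position (suc i) ∸ suc (position (lookup p i)))))
      ≡⟨ cong sum (tabulate-cong (λ i → suc[k∸suc[m]] (parent-earlier {suc i} (λ ())))) ⟩
    sum (tabulate (displacement ∘ suc)) ∎
    where
      open ≡-Reasoning
      suc[k∸suc[m]] : ∀ {m k} → m < k → suc (k ∸ suc m) ≡ k ∸ m
      suc[k∸suc[m]] {m} {suc k} m<k = sym (+-∸-assoc 1 (s≤s⁻¹ m<k))

  isParentJustBefore : Vertex n → Bool
  isParentJustBefore v = suc (position (par v)) ≡ᵇ position v

  psa≡count-parentJustBefore : psa p ≡ count isParentJustBefore (tabulate suc)
  psa≡count-parentJustBefore = begin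
    count (λ ij → suc (proj₂ ij) ≡ᵇ proj₁ ij) (map (λ i → i , position (par (L ! i))) (map suc (upTo n)))
      ≡⟨ count-map _ _ (map suc (upTo n)) ⟩
    count (λ i → suc (position (par (L ! i))) ≡ᵇ i) (map suc (upTo n))
      ≡⟨ count-cong-∈ _ _ (map suc (upTo n)) (λ {i} i∈ → cong (suc (position (par (L ! i))) ≡ᵇ_)
                                                                (sym (position-!-nonroot i∈))) ⟩
    count (isParentJustBefore ∘ (L !_)) (map suc (upTo n))
      ≡⟨ count-map isParentJustBefore (L !_) (map suc (upTo n)) ⟨
    count isParentJustBefore (map (L !_) (map suc (upTo n)))
      ≡⟨ count-↭ isParentJustBefore nonroot↭ ⟩
    count isParentJustBefore (tabulate suc) ∎
    where open ≡-Reasoning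

  lucky≡count-parentJustBefore : lucky (toPF p) ≡ count isParentJustBefore (tabulate suc)
  lucky≡count-parentJustBefore = begin
    count id (zipWith _≡ᵇ_ (spots (toPF p)) (prefs (toPF p)))
      ≡⟨ cong₂ (λ S P → count id (zipWith _≡ᵇ_ S P)) spots-toPF prefs-toPF ⟩
    count id (zipWith _≡ᵇ_ parkingSpots preferences)
      ≡⟨ cong (count id) (zipWith-tabulate _≡ᵇ_ (position ∘ suc) (suc ∘ position ∘ lookup p)) ⟩
    count id (tabulate (λ i → position (suc i) ≡ᵇ suc (position (lookup p i))))
      ≡⟨ count-tabulate-cong id isParentJustBefore _ suc (λ i → ≡ᵇ-comm (position (suc i)) _) ⟩
    count isParentJustBefore (tabulate suc) ∎
    where open ≡-Reasoning

  degRoot≡ones : degRoot p ≡ ones (toPF p)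
  degRoot≡ones = begin
    count isZero (toList p)                ≡⟨ cong (count isZero) (toList≡tabulate-lookup p) ⟩
    count isZero (tabulate (lookup p))     ≡⟨ count-tabulate-cong isZero (1 ≡ᵇ_) (lookup p) _ (isZero≡ ∘ lookup p) ⟩
    count (1 ≡ᵇ_) preferences              ≡⟨ cong (count (1 ≡ᵇ_)) prefs-toPF ⟨
    count (1 ≡ᵇ_) (prefs (toPF p))         ∎
    where
      open ≡-Reasoning
      isZero≡ : ∀ u → isZero u ≡ (0 ≡ᵇ position u)
      isZero≡ u = T-injective (mk⇔ to from)
        where
          to : T (isZero u) → T (0 ≡ᵇ position u)
          to t with refl ← toℕ-injective {i = u} {zero} (Equivalence.to T-isZero⇔ t) =
            subst (T ∘ (0 ≡ᵇ_)) (sym position-root) tt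
          from : T (0 ≡ᵇ position u) → T (isZero u)
          from t =
            Equivalence.from T-isZero⇔ (cong toℕ (position-injective (trans (sym (≡ᵇ⇒≡ 0 _ t)) (sym position-root))))

  children-count : ∀ {j} → j < suc n → count (suc j ≡ᵇ_) preferences ≡ childCount p (L ! j)
  children-count {j} j< = begin
    count (suc j ≡ᵇ_) preferences            ≡⟨ count-tabulate-cong _ (_== L ! j) _ (lookup p) (is-child ∘ lookup p) ⟩
    count (_== L ! j) (tabulate (lookup p))  ≡⟨ cong (count (_== L ! j)) (toList≡tabulate-lookup p) ⟨
    childCount p (L ! j)                     ∎
    where
      open ≡-Reasoning
      is-child : ∀ u → (j ≡ᵇ position u) ≡ (u == L ! j)
      is-child u = T-injective (mk⇔
        (λ t → ≡⇒== (trans (sym (!-position u)) (cong (L !_) (sym (≡ᵇ⇒≡ j _ t)))))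
        (λ t → ≡⇒≡ᵇ j _ (sym (trans (cong position (==⇒≡ t)) (position-! j<)))))

  chseq≡mult : chseq p ≡ mult (toPF p)
  chseq≡mult = map-cong (λ i → sym (vertices-with-children i)) (upTo (suc n))
    where
      open ≡-Reasoning
      vertices-with-children : ∀ i → count (λ v → count (v ≡ᵇ_) (prefs (toPF p)) ≡ᵇ i) (map suc (upTo (suc n))) ≡
                                     count (λ v → childCount p v ≡ᵇ i) (allFin (suc n))
      vertices-with-children i = begin
        count (λ v → count (v ≡ᵇ_) (prefs (toPF p)) ≡ᵇ i) (map suc (upTo (suc n)))
          ≡⟨ cong (λ P → count (λ v → count (v ≡ᵇ_) P ≡ᵇ i) (map suc (upTo (suc n)))) prefs-toPF ⟩
        count (λ v → count (v ≡ᵇ_) preferences ≡ᵇ i) (map suc (upTo (suc n)))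
          ≡⟨ count-map (λ v → count (v ≡ᵇ_) preferences ≡ᵇ i) suc (upTo (suc n)) ⟩
        count (λ j → count (suc j ≡ᵇ_) preferences ≡ᵇ i) (upTo (suc n))
          ≡⟨ count-cong-∈ _ _ (upTo (suc n)) (λ j∈ → cong (_≡ᵇ i) (children-count (∈-upTo⁻ j∈))) ⟩
        count (λ j → childCount p (L ! j) ≡ᵇ i) (upTo (suc n))
          ≡⟨ count-map (λ v → childCount p v ≡ᵇ i) (L !_) (upTo (suc n)) ⟨
        count (λ v → childCount p v ≡ᵇ i) (map (L !_) (upTo (suc n)))
          ≡⟨ cong (count (λ v → childCount p v ≡ᵇ i)) L≡map-! ⟨
        count (λ v → childCount p v ≡ᵇ i) L
          ≡⟨ count-↭ (λ v → childCount p v ≡ᵇ i) L↭allFin ⟩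
        count (λ v → childCount p v ≡ᵇ i) (allFin (suc n)) ∎

  IsRecord : Vertex n → Set
  IsRecord v = ∀ {t} → t < suc n → toℕ (iter t par v) ≤ toℕ v

  isRecordᵇ⇔IsRecord : ∀ v → T (isRecordᵇ p v) ⇔ IsRecord v
  isRecordᵇ⇔IsRecord v = mk⇔ to from
    where
      test : ℕ → Bool
      test t = toℕ (iter t par v) ≤ᵇ toℕ v
      to : T (isRecordᵇ p v) → IsRecord v
      to r t< = ≤ᵇ⇒≤ _ _ (All.lookup (All.all⁺ test (upTo (suc n)) r) (∈-upTo⁺ t<))
      from : IsRecord v → T (isRecordᵇ p v)
      from r = All.all⁻ test (All.tabulate (λ t∈ → ≤⇒≤ᵇ (r (∈-upTo⁻ t∈))))

  PrecededBySmaller : Vertex n → Set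
  PrecededBySmaller v = ∀ {j} → 0 < j → j < position v → toℕ (L ! j) < toℕ v

  IsRecord⇔PrecededBySmaller : ∀ {v} → v ≢ zero → IsRecord v ⇔ PrecededBySmaller v
  IsRecord⇔PrecededBySmaller {v} v≢0 = mk⇔ to from
    where
      -- The path from v to the root leaves take j L through a frontier vertex, which lies
      -- between L ! j (the least frontier vertex) and v (a record).
      to : IsRecord v → PrecededBySmaller v
      to record-v {j} 0<j j<pos = through-frontier (ancestor-in-frontier n v∉ root∈)
        where
          j<suc : j < suc n
          j<suc = <-trans j<pos (position-< v)
          v∉ : v ∉ take j L
          v∉ v∈ = <⇒≱ (∈take⇒position< v∈) (<⇒≤ j<pos)
          root∈ : iter n par v ∈ take j L
          root∈ = subst (_∈ take j L) (sym (isTree v)) (position<⇒∈take (subst (_< j) (sym position-root) 0<j))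
          through-frontier : ∃[ s ] s < n × Frontier (take j L) (iter s par v) → toℕ (L ! j) < toℕ v
          through-frontier (s , s<n , frontier) =
            ≤∧≢⇒< (≤-trans (minimum-at 0<j j<suc frontier) (record-v (<-trans s<n (n<1+n n))))
                  (λ e → <-irrefl (trans (sym (position-! j<suc)) (cong position (toℕ-injective e))) j<pos)
      from : PrecededBySmaller v → IsRecord v
      from earlier {t} _ with position (iter t par v) in e
      ... | zero  = subst (λ u → toℕ u ≤ toℕ v) (position-injective (trans position-root (sym e))) z≤n
      ... | suc k with suc k ≟ position v
      ...   | yes k≡ = ≤-reflexive (cong toℕ (position-injective (trans e k≡)))
      ...   | no  k≢ = <⇒≤ (subst (λ u → toℕ u < toℕ v) (trans (cong (L !_) (sym e)) (!-position _))
                                 (earlier (s≤s z≤n) (≤∧≢⇒< k≤ k≢)))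
        where
          k≤ : suc k ≤ position v
          k≤ = subst (_≤ position v) e (≤-trans (position-iter t v) (m∸n≤m _ t))

  LeftToRightMax⇔PrecededBySmaller : (i : Fin n) →
                                     LeftToRightMaxAbove 0 (suc (toℕ i)) nonrootLabels ⇔ PrecededBySmaller (suc i)
  LeftToRightMax⇔PrecededBySmaller i = mk⇔ to from
    where
      to : LeftToRightMaxAbove 0 (suc (toℕ i)) nonrootLabels → PrecededBySmaller (suc i)
      to (k , k< , label-k , _ , before) {suc j} _ j<pos = subst (_< suc (toℕ i)) (nonrootLabels-! j<n) (before j<k)
        where
          k<n : k < n
          k<n = subst (k <_) length-nonrootLabels k<
          pos≡ : position (suc i) ≡ suc k
          pos≡ = trans (cong position (toℕ-injective (trans (sym label-k) (nonrootLabels-! k<n)))) (position-! (s≤s k<n))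
          j<k : j < k
          j<k = s≤s⁻¹ (subst (suc j <_) pos≡ j<pos)
          j<n : j < n
          j<n = <-trans j<k k<n
      from : PrecededBySmaller (suc i) → LeftToRightMaxAbove 0 (suc (toℕ i)) nonrootLabels
      from earlier with position (suc i) in e | position-nonroot {suc i} (λ ())
      ... | suc k | _ = k , subst (k <_) (sym length-nonrootLabels) k<n , label-k , s≤s z≤n , smaller
        where
          k<n : k < n
          k<n = s≤s⁻¹ (subst (_< suc n) e (position-< (suc i)))
          label-k : nthOr 0 nonrootLabels k ≡ suc (toℕ i)
          label-k = trans (nonrootLabels-! k<n) (cong toℕ (trans (cong (L !_) (sym e)) (!-position (suc i))))
          smaller : ∀ {j} → j < k → nthOr 0 nonrootLabels j < suc (toℕ i)
          smaller {j} j<k = subst (_< suc (toℕ i)) (sym (nonrootLabels-! (<-trans j<k k<n)))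
                                  (earlier (s≤s z≤n) (subst (suc j <_) (sym e) (s≤s j<k)))

  recT≡recP : recT p ≡ recP (toPF p)
  recT≡recP = Vec.tabulate-cong (λ i → trans (T-injective (record-test i))
                                              (cong (λ w → any (suc (toℕ i) ≡ᵇ_) (lrMaxFrom 0 w)) (sym carWord-toPF)))
    where
      record-test : (i : Fin n) → T (isRecordᵇ p (suc i)) ⇔ T (any (suc (toℕ i) ≡ᵇ_) (lrMaxFrom 0 nonrootLabels))
      record-test i = isRecordᵇ⇔IsRecord (suc i)                  ⟨ ⇔.trans ⟩
                      IsRecord⇔PrecededBySmaller (λ ())           ⟨ ⇔.trans ⟩
                      ⇔.sym (LeftToRightMax⇔PrecededBySmaller i)  ⟨ ⇔.trans ⟩
                      ⇔.sym (lrMaxFrom⇔ 0 _ nonrootLabels)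

  wait≡probes : wait p ≡ probes (toPF p)
  wait≡probes = trans wait≡sum-displacement (sym probes≡sum-displacement)

  psa≡lucky : psa p ≡ lucky (toPF p)
  psa≡lucky = trans psa≡count-parentJustBefore (sym lucky≡count-parentJustBefore)

  treeMono≡pfMono : treeMono p ≡ pfMono (toPF p)
  treeMono≡pfMono =
    cong₂ _,_ recT≡recP (cong₂ _,_ wait≡probes (cong₂ _,_ psa≡lucky (cong₂ _,_ degRoot≡ones
      (cong (λ cs → expVec (suc (suc n)) cs , n) chseq≡mult))))

trees-isTree : {n : ℕ} {p : Parents n} → p ∈ trees n → T (isTreeᵇ p)
trees-isTree {n} p∈ = proj₂ (∈-filter⁻ (T? ∘ isTreeᵇ) {xs = allVecs (suc n) n} p∈)

pfs-isPF : {n : ℕ} {a : Vec (Fin n) n} → a ∈ pfs n → T (isPFᵇ a)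
pfs-isPF {n} a∈ = proj₂ (∈-filter⁻ (T? ∘ isPFᵇ) {xs = allVecs n n} a∈)

toPF-↭ : (n : ℕ) → map toPF (trees n) ↭ pfs n
toPF-↭ n = map↭-of-inverses toPF toTree
  (Unique.filter⁺ (T? ∘ isTreeᵇ) (allVecs-unique (suc n) n)) (Unique.filter⁺ (T? ∘ isPFᵇ) (allVecs-unique n n))
  (λ {p} p∈ → ∈-filter⁺ (T? ∘ isPFᵇ) (allVecs-complete n n (toPF p)) (Forward.toPF-isPF p (trees-isTree p∈)))
  (λ {a} a∈ → ∈-filter⁺ (T? ∘ isTreeᵇ) (allVecs-complete (suc n) n (toTree a))
                         (Backward.toTree-isTree a (pfs-isPF a∈)))
  (λ {p} p∈ → Forward.toTree-toPF p (trees-isTree p∈))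
  (λ {a} a∈ → Backward.toPF-toTree a (pfs-isPF a∈))

corollary4p2 : (n : ℕ) → map treeMono (trees n) ↭ map pfMono (pfs n)
corollary4p2 n = begin
  map treeMono (trees n)            ≡⟨ map-cong-local (All.tabulate same-monomial) ⟩
  map (pfMono ∘ toPF) (trees n)     ≡⟨ map-∘ (trees n) ⟩
  map pfMono (map toPF (trees n))   ↭⟨ map⁺ pfMono (toPF-↭ n) ⟩
  map pfMono (pfs n)                ∎
  where
    open PermutationReasoning
    same-monomial : ∀ {p} → p ∈ trees n → treeMono p ≡ pfMono (toPF p)
    same-monomial {p} p∈ = Statistics.treeMono≡pfMono p (trees-isTree p∈)
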